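{- Let $\Gamma$ be the context $x_1:\mathbb N,\dots,x_m:\mathbb N,X_1:\mathrm{Set}(\mathbb N),\dots,X_n:\mathrm{Set}(\mathbb N)$. Let $t$ be a term of $\mathcal L$ with free variables among $x_1,\dots,x_m$, and $\phi$ a formula of $\mathcal L$ with free variables among $x_1,\dots,x_m,X_1,\dots,X_n$. Then: (1) $\Gamma\vdash\langle t\rangle:\mathbb N$ and $\Gamma\vdash\langle\phi\rangle\ \mathrm{Prop}$ are derivable in $\mathrm{LTT}_\mathrm{W}$; (2) if $\phi$ is arithmetic, then $\Gamma\vdash\langle\!\langle\phi\rangle\!\rangle\ \mathrm{prop}$ and $\Gamma\vdash V(\langle\!\langle\phi\rangle\!\rangle)=\langle\phi\rangle$ are derivable in $\mathrm{LTT}_\mathrm{W}$; (3) if $\mathrm{ACA}_0\vdash\phi$, then $\Gamma\vdash\ \Rightarrow\langle\phi\rangle$ is derivable in $\mathrm{LTT}_0$; (4) if $\mathrm{ACA}\vdash\phi$, then $\Gamma\vdash\ \Rightarrow\langle\phi\rangle$ is derivable in $\mathrm{LTT}_0^*$.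
   Context: Second order arithmetic. The language $\mathcal L$ has number variables $x,y,z,\dots$ and set variables $X,Y,Z,\dots$; terms $t::=x\mid 0\mid \mathrm S t\mid t+t\mid t\cdot t$; formulas $\phi::=t=t\mid t\in X\mid\bot\mid\phi\supset\phi\mid\forall x\phi\mid\forall X\phi$, with $\neg,\wedge,\vee,\leftrightarrow,\exists$ defined classically. A formula is arithmetic if it contains no set quantifier. $\mathrm{ACA}_0$ is the classical two-sorted theory with equality whose axioms are: $\mathrm Sx\neq0$; $\mathrm Sx=\mathrm Sy\supset x=y$; $x+0=x$; $x+\mathrm Sy=\mathrm S(x+y)$; $x\cdot0=0$; $x\cdot\mathrm Sy=x\cdot y+x$; arithmetical comprehension $\exists X\forall x(x\in X\leftrightarrow\phi)$ for each arithmetic $\phi$ in which $X$ is not free; set induction $0\in X\supset\forall x(x\in X\supset\mathrm Sx\in X)\supset\forall x.\,x\in X$. $\mathrm{ACA}$ is $\mathrm{ACA}_0$ plus $[0/x]\phi\supset\forall x(\phi\supset[\mathrm Sx/x]\phi)\supset\forall x\phi$ for every formula $\phi$. The logic-enriched type theory $\mathrm{LTT}_\mathrm{W}$. Expressions are identified up to $\alpha$-conversion; $[M/x]X$ is capture-avoiding substitution. Types: $A::=\mathbb N\mid A\times A\mid A\to A\mid U\mid T(M)\mid\mathrm{Set}(A)$. Terms: $M::=x\mid0\mid\mathrm sM\mid\mathrm E_{\mathbb N}([x]A,M,[x,y]M,M)\mid(M,M)_{A\times B}\mid\pi_1^{A\times B}(M)\mid\pi_2^{A\times B}(M)\mid\lambda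 x{:}A.M{:}B\mid M(M)_{A\to B}\mid\hat{\mathbb N}\mid M\mathbin{\hat\times}M\mid\{x:A\mid P\}$. Names of small propositions: $P::=M\mathbin{\hat=}_M M\mid\hat\bot\mid P\mathbin{\hat\supset}P\mid\hat\forall x{:}M.P\mid M\mathbin{\hat\in}_A M$. Propositions: $\phi::=M=_M M\mid\bot\mid\phi\supset\phi\mid\forall x{:}A.\phi\mid V(P)$. Abbreviations: $\neg\phi:=\phi\supset\bot$, $\phi\wedge\psi:=\neg(\phi\supset\neg\psi)$, $\phi\vee\psi:=\neg\phi\supset\psi$, $\leftrightarrow$ as usual, $\exists x{:}A.\phi:=\neg\forall x{:}A.\neg\phi$, $M\in_A N:=V(M\mathbin{\hat\in}_A N)$, and hatted analogues ($\hat\neg$ etc.) for small propositions. Contexts are $x_1{:}A_1,\dots,x_n{:}A_n$ with distinct variables. Judgements $\Gamma\vdash\mathcal J$ with $\mathcal J$ one of: $\mathrm{valid}$, $A\ \mathrm{type}$, $A=B$, $M:A$, $M=N:A$, $P\ \mathrm{prop}$, $P=Q$, $\phi\ \mathrm{Prop}$, $\phi=\psi$, $\phi_1,\dots,\phi_n\Rightarrow\psi$. Rules: (i) structural: empty context valid; $\Gamma\vdash A\ \mathrm{type}$ gives $\Gamma,x{:}A\vdash\mathrm{valid}$; declared variables have their types; the judgemental equalities are equivalence relations; typings and term equalities transfer along type equality; $\Gamma\vdash\phi_1,\dots,\phi_n\Rightarrow\phi_i$ when all $\phi_j$ are propositions; an entailed proposition may be replaced by a judgementally equal one. (ii) Formation/typing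 rules and congruence rules for every constructor: $\mathbb N$ type, $0:\mathbb N$, $\mathrm sM:\mathbb N$; if $\Gamma,x{:}\mathbb N\vdash C\ \mathrm{type}$, $\Gamma\vdash L:[0/x]C$, $\Gamma,x{:}\mathbb N,y{:}C\vdash M:[\mathrm sx/x]C$, $\Gamma\vdash N:\mathbb N$ then $\mathrm E_{\mathbb N}([x]C,L,[x,y]M,N):[N/x]C$, with $\mathrm E_{\mathbb N}([x]C,L,[x,y]M,0)=L$ and $\mathrm E_{\mathbb N}([x]C,L,[x,y]M,\mathrm sN)=[N/x,\mathrm E_{\mathbb N}([x]C,L,[x,y]M,N)/y]M$; pairs, projections with $\pi_i((M_1,M_2))=M_i$; $\lambda$-abstraction, application, $\beta$-rule; $\{x:A\mid P\}:\mathrm{Set}(A)$ when $\Gamma,x{:}A\vdash P\ \mathrm{prop}$, $M\mathbin{\hat\in}_AN\ \mathrm{prop}$ for $M:A,N:\mathrm{Set}(A)$, and $(M\mathbin{\hat\in}_A\{x:A\mid P\})=[M/x]P$; $U$ type, $T(M)$ type for $M:U$, $\hat{\mathbb N}:U$, $M\mathbin{\hat\times}N:U$ for $M,N:U$, $T(\hat{\mathbb N})=\mathbb N$, $T(M\mathbin{\hat\times}N)=T(M)\times T(N)$; $V(P)$ Prop for $P$ prop; $V(\hat\bot)=\bot$; $V(P\mathbin{\hat\supset}Q)=V(P)\supset V(Q)$; if $\Gamma,x{:}T(M)\vdash P\ \mathrm{prop}$ then $\hat\forall x{:}M.P$ prop and $V(\hat\forall x{:}M.P)=\forall x{:}T(M).V(P)$;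 for $M_1,M_2:T(N)$, $M_1=_NM_2$ is a proposition, $M_1\mathbin{\hat=}_NM_2$ prop and $V(M_1\mathbin{\hat=}_NM_2)=(M_1=_NM_2)$; $\bot$, $\phi\supset\psi$, $\forall x{:}A.\phi$ are propositions. (iii) Classical logic: $\bot$-elimination, $\supset$-introduction/elimination, double-negation elimination, $\forall$-introduction and $\forall$-elimination over any type. (iv) Equality: $\Phi\Rightarrow M=_NM$ for $M:T(N)$; (subst): from $\Gamma,x{:}T(N)\vdash\phi\ \mathrm{Prop}$, $\Gamma\vdash\Phi\Rightarrow M_1=_NM_2$, $\Gamma\vdash\Phi\Rightarrow[M_1/x]\phi$ infer $\Gamma\vdash\Phi\Rightarrow[M_2/x]\phi$. (v) $(\mathrm{eta}_\times)$: for $M:A\times B$, from $\Phi\Rightarrow[(\pi_1M,\pi_2M)/z]\phi$ infer $\Phi\Rightarrow[M/z]\phi$; $(\mathrm{eta}_\to)$: for $M:A\to B$, from $\Phi\Rightarrow[\lambda x{:}A.M(x){:}B/z]\phi$ infer $\Phi\Rightarrow[M/z]\phi$. (vi) $(\mathrm{Ind}_{\mathbb N})$: from $\Gamma,x{:}\mathbb N\vdash\phi\ \mathrm{Prop}$, $\Gamma\vdash N:\mathbb N$, $\Gamma\vdash\Phi\Rightarrow[0/x]\phi$, $\Gamma,x{:}\mathbb N\vdash\Phi,\phi\Rightarrow[\mathrm sx/x]\phi$ infer $\Gamma\vdash\Phi\Rightarrow[N/x]\phi$. $\mathrm{LTT}_0$ is obtained from $\mathrm{LTT}_\mathrm{W}$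 by: allowing the $\mathrm E_{\mathbb N}$ rules only when $C$ has the form $T(K)$; allowing $(\mathrm{Ind}_{\mathbb N})$ only when $\phi$ has the form $V(P)$; allowing (subst), $(\mathrm{eta}_\times)$, $(\mathrm{eta}_\to)$ only when no quantifier $\forall x{:}A$ in $\phi$ has $A$ containing $U$; and adding the rule $\Gamma\vdash\phi_1,\dots,\phi_n\Rightarrow\neg(0=_{\hat{\mathbb N}}\mathrm sM)$ for $\Gamma\vdash M:\mathbb N$ and propositions $\phi_i$. A proposition is analytic if every quantifier $\forall x{:}A$ in it has $A\equiv T(M)$ for some $M$ or $A\equiv\mathrm{Set}(\mathbb N)$. $\mathrm{LTT}_0^*$ is $\mathrm{LTT}_0$ with $(\mathrm{Ind}_{\mathbb N})$ allowed for every analytic $\phi$. Translation. $\langle x\rangle\equiv x$, $\langle0\rangle\equiv0$, $\langle\mathrm St\rangle\equiv\mathrm s\langle t\rangle$, $\langle s+t\rangle\equiv\langle s\rangle\ \mathtt{plus}\ \langle t\rangle$, $\langle s\cdot t\rangle\equiv\langle s\rangle\ \mathtt{times}\ \langle t\rangle$, where $M\ \mathtt{plus}\ N\equiv\mathrm E_{\mathbb N}([x]T(\hat{\mathbb N}),M,[x,y]\mathrm sy,N)$ and $M\ \mathtt{times}\ N\equiv\mathrm E_{\mathbb N}([x]T(\hat{\mathbb N}),0,[x,y]\,y\ \mathtt{plus}\ M,N)$. For arithmetic $\phi$: $\langle\!\langle s=t\rangle\!\rangle\equiv\langle s\rangle\mathbin{\hat=}_{\hat{\mathbb N}}\langle t\rangle$,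 $\langle\!\langle t\in X\rangle\!\rangle\equiv\langle t\rangle\mathbin{\hat\in}_{\mathbb N}X$, $\langle\!\langle\neg\phi\rangle\!\rangle\equiv\hat\neg\langle\!\langle\phi\rangle\!\rangle$, $\langle\!\langle\phi\supset\psi\rangle\!\rangle\equiv\langle\!\langle\phi\rangle\!\rangle\mathbin{\hat\supset}\langle\!\langle\psi\rangle\!\rangle$, $\langle\!\langle\forall x\phi\rangle\!\rangle\equiv\hat\forall x{:}\hat{\mathbb N}.\langle\!\langle\phi\rangle\!\rangle$. For all $\phi$: $\langle s=t\rangle\equiv\langle s\rangle=_{\hat{\mathbb N}}\langle t\rangle$, $\langle t\in X\rangle\equiv\langle t\rangle\in_{\mathbb N}X$, $\langle\neg\phi\rangle\equiv\neg\langle\phi\rangle$, $\langle\phi\supset\psi\rangle\equiv\langle\phi\rangle\supset\langle\psi\rangle$, $\langle\forall x\phi\rangle\equiv\forall x{:}\mathbb N.\langle\phi\rangle$, $\langle\forall X\phi\rangle\equiv\forall X{:}\mathrm{Set}(\mathbb N).\langle\phi\rangle$ (set variables of $\mathcal L$ become variables of type $\mathrm{Set}(\mathbb N)$). -}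

module Defs where

open import Data.Nat using (ℕ; zero; suc)
open import Data.List using (List; []; _∷_; map; replicate; _++_)
open import Data.List.Membership.Propositional using (_∈_)
open import Data.List.Relation.Unary.All using (All)
open import Data.Bool using (Bool; true; false; _∨_)
open import Data.Unit using (⊤)
open import Data.Empty using (⊥)
open import Data.Product using (_×_)
open import Relation.Binary.PropositionalEquality using (_≡_)

-- Intrinsically scoped and sorted de Bruijn syntax (α-equivalence is
-- syntactic identity).  A sort context lists the sorts of the free
-- variables, innermost (most recently bound) first.

data Sort : Set where
  num set : Sort

SCtx : Set
SCtx = List Sort

data Var : SCtx → Sort → Set where
  vz : ∀ {Δ s} → Var (s ∷ Δ) s
  vs : ∀ {Δ s s'} → Var Δ s → Var (s' ∷ Δ) s

varIdx : ∀ {Δ s} → Var Δ s → ℕ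
varIdx vz     = zero
varIdx (vs x) = suc (varIdx x)

data LTm (Δ : SCtx) : Set where
  lv   : Var Δ num → LTm Δ
  lO   : LTm Δ
  lS   : LTm Δ → LTm Δ
  _l+_ : LTm Δ → LTm Δ → LTm Δ
  _l·_ : LTm Δ → LTm Δ → LTm Δ

data LFm (Δ : SCtx) : Set where
  _l≈_  : LTm Δ → LTm Δ → LFm Δ
  _l∈_  : LTm Δ → Var Δ set → LFm Δ
  l⊥    : LFm Δ
  _l⊃_  : LFm Δ → LFm Δ → LFm Δ
  l∀n   : LFm (num ∷ Δ) → LFm Δ
  l∀s   : LFm (set ∷ Δ) → LFm Δ

l¬ : ∀ {Δ} → LFm Δ → LFm Δ
l¬ φ = φ l⊃ l⊥

_l∧_ : ∀ {Δ} → LFm Δ → LFm Δ → LFm Δ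
φ l∧ ψ = l¬ (φ l⊃ l¬ ψ)

_l↔_ : ∀ {Δ} → LFm Δ → LFm Δ → LFm Δ
φ l↔ ψ = (φ l⊃ ψ) l∧ (ψ l⊃ φ)

l∃s : ∀ {Δ} → LFm (set ∷ Δ) → LFm Δ
l∃s φ = l¬ (l∀s (l¬ φ))

data Arith {Δ : SCtx} : LFm Δ → Set where
  a≈ : ∀ {s t} → Arith (s l≈ t)
  a∈ : ∀ {t X} → Arith (t l∈ X)
  a⊥ : Arith l⊥
  a⊃ : ∀ {φ ψ} → Arith φ → Arith ψ → Arith (φ l⊃ ψ)
  a∀ : ∀ {φ} → Arith φ → Arith (l∀n φ)

Ren : SCtx → SCtx → Set
Ren Δ Δ' = ∀ {s} → Var Δ s → Var Δ' s

liftRen : ∀ {Δ Δ' s} → Ren Δ Δ' → Ren (s ∷ Δ) (s ∷ Δ')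
liftRen ρ vz     = vz
liftRen ρ (vs x) = vs (ρ x)

renLTm : ∀ {Δ Δ'} → Ren Δ Δ' → LTm Δ → LTm Δ'
renLTm ρ (lv x)   = lv (ρ x)
renLTm ρ lO       = lO
renLTm ρ (lS t)   = lS (renLTm ρ t)
renLTm ρ (s l+ t) = renLTm ρ s l+ renLTm ρ t
renLTm ρ (s l· t) = renLTm ρ s l· renLTm ρ t

renLFm : ∀ {Δ Δ'} → Ren Δ Δ' → LFm Δ → LFm Δ'
renLFm ρ (s l≈ t) = renLTm ρ s l≈ renLTm ρ t
renLFm ρ (t l∈ X) = renLTm ρ t l∈ ρ X
renLFm ρ l⊥       = l⊥
renLFm ρ (φ l⊃ ψ) = renLFm ρ φ l⊃ renLFm ρ ψ
renLFm ρ (l∀n φ)  = l∀n (renLFm (liftRen ρ) φ)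
renLFm ρ (l∀s φ)  = l∀s (renLFm (liftRen ρ) φ)

wkLFm : ∀ {Δ s} → LFm Δ → LFm (s ∷ Δ)
wkLFm = renLFm vs

Val : Sort → SCtx → Set
Val num Δ = LTm Δ
Val set Δ = Var Δ set

varVal : ∀ {Δ} s → Var Δ s → Val s Δ
varVal num x = lv x
varVal set x = x

wkVal : ∀ {Δ s'} s → Val s Δ → Val s (s' ∷ Δ)
wkVal num t = renLTm vs t
wkVal set x = vs x

LSub : SCtx → SCtx → Set
LSub Δ Δ' = ∀ {s} → Var Δ s → Val s Δ'

liftLSub : ∀ {Δ Δ' s'} → LSub Δ Δ' → LSub (s' ∷ Δ) (s' ∷ Δ')
liftLSub σ {s} vz     = varVal s vz
liftLSub σ {s} (vs x) = wkVal s (σ x)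

subLTm : ∀ {Δ Δ'} → LSub Δ Δ' → LTm Δ → LTm Δ'
subLTm σ (lv x)   = σ x
subLTm σ lO       = lO
subLTm σ (lS t)   = lS (subLTm σ t)
subLTm σ (s l+ t) = subLTm σ s l+ subLTm σ t
subLTm σ (s l· t) = subLTm σ s l· subLTm σ t

subLFm : ∀ {Δ Δ'} → LSub Δ Δ' → LFm Δ → LFm Δ'
subLFm σ (s l≈ t) = subLTm σ s l≈ subLTm σ t
subLFm σ (t l∈ X) = subLTm σ t l∈ σ X
subLFm σ l⊥       = l⊥
subLFm σ (φ l⊃ ψ) = subLFm σ φ l⊃ subLFm σ ψ
subLFm σ (l∀n φ)  = l∀n (subLFm (liftLSub σ) φ)
subLFm σ (l∀s φ)  = l∀s (subLFm (liftLSub σ) φ)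

inst0 : ∀ {Δ s} → Val s Δ → LSub (s ∷ Δ) Δ
inst0 {s = s} a {.s} vz = a
inst0 a {s'} (vs x)     = varVal s' x

_[_]ⁿ : ∀ {Δ} → LFm (num ∷ Δ) → LTm Δ → LFm Δ
φ [ t ]ⁿ = subLFm (inst0 t) φ

_[_]ˢ : ∀ {Δ} → LFm (set ∷ Δ) → Var Δ set → LFm Δ
φ [ X ]ˢ = subLFm (inst0 X) φ

sucSubL : ∀ {Δ} → LSub (num ∷ Δ) (num ∷ Δ)
sucSubL {s = .num} vz = lS (lv vz)
sucSubL {s = s} (vs x) = varVal s (vs x)

data Theory : Set where
  ACA₀ ACA : Theory

private
  x₀ : ∀ {Δ} → LTm (num ∷ Δ)
  x₀ = lv vz
  x₁ : ∀ {Δ} → LTm (num ∷ num ∷ Δ)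
  x₁ = lv (vs vz)

-- comprehension instance  ∃X ∀x (x ∈ X ↔ φ), X not free in φ
comprehension : ∀ {Δ} → LFm (num ∷ Δ) → LFm Δ
comprehension φ =
  l∃s (l∀n ((lv vz l∈ vs vz) l↔ renLFm (liftRen vs) φ))

-- set induction  ∀X (0 ∈ X ⊃ ∀x(x ∈ X ⊃ Sx ∈ X) ⊃ ∀x. x ∈ X)
-- (the universal closure of the axiom with free X)
setInduction : ∀ {Δ} → LFm Δ
setInduction =
  l∀s ((lO l∈ vz) l⊃
       (l∀n ((lv vz l∈ vs vz) l⊃ (lS (lv vz) l∈ vs vz)) l⊃
        l∀n (lv vz l∈ vs vz)))

inductionScheme : ∀ {Δ} → LFm (num ∷ Δ) → LFm Δ
inductionScheme φ =
  (φ [ lO ]ⁿ) l⊃ (l∀n (φ l⊃ subLFm sucSubL φ) l⊃ l∀n φ)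

-- axioms (the open arithmetic axioms are taken in universally closed form)
data Axiom : Theory → (Δ : SCtx) → LFm Δ → Set where
  axSuc0   : ∀ {T Δ} → Axiom T Δ (l∀n (l¬ (lS x₀ l≈ lO)))
  axSucInj : ∀ {T Δ} → Axiom T Δ (l∀n (l∀n ((lS x₁ l≈ lS x₀) l⊃ (x₁ l≈ x₀))))
  axAdd0   : ∀ {T Δ} → Axiom T Δ (l∀n ((x₀ l+ lO) l≈ x₀))
  axAddS   : ∀ {T Δ} → Axiom T Δ (l∀n (l∀n ((x₁ l+ lS x₀) l≈ lS (x₁ l+ x₀))))
  axMul0   : ∀ {T Δ} → Axiom T Δ (l∀n ((x₀ l· lO) l≈ lO))
  axMulS   : ∀ {T Δ} → Axiom T Δ (l∀n (l∀n ((x₁ l· lS x₀) l≈ ((x₁ l· x₀) l+ x₁))))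
  axComp   : ∀ {T Δ} (φ : LFm (num ∷ Δ)) → Arith φ → Axiom T Δ (comprehension φ)
  axSetInd : ∀ {T Δ} → Axiom T Δ setInduction
  axInd    : ∀ {Δ} (φ : LFm (num ∷ Δ)) → Axiom ACA Δ (inductionScheme φ)

data Prf (T : Theory) : (Δ : SCtx) → List (LFm Δ) → LFm Δ → Set where
  hyp  : ∀ {Δ Hs φ} → φ ∈ Hs → Prf T Δ Hs φ
  ax   : ∀ {Δ Hs φ} → Axiom T Δ φ → Prf T Δ Hs φ
  ⊥e   : ∀ {Δ Hs φ} → Prf T Δ Hs l⊥ → Prf T Δ Hs φ
  ⊃i   : ∀ {Δ Hs φ ψ} → Prf T Δ (φ ∷ Hs) ψ → Prf T Δ Hs (φ l⊃ ψ)
  ⊃e   : ∀ {Δ Hs φ ψ} → Prf T Δ Hs (φ l⊃ ψ) → Prf T Δ Hs φ → Prf T Δ Hs ψ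
  dne  : ∀ {Δ Hs φ} → Prf T Δ Hs (l¬ (l¬ φ)) → Prf T Δ Hs φ
  ∀ni  : ∀ {Δ Hs φ} → Prf T (num ∷ Δ) (map wkLFm Hs) φ → Prf T Δ Hs (l∀n φ)
  ∀ne  : ∀ {Δ Hs φ} → Prf T Δ Hs (l∀n φ) → (t : LTm Δ) → Prf T Δ Hs (φ [ t ]ⁿ)
  ∀si  : ∀ {Δ Hs φ} → Prf T (set ∷ Δ) (map wkLFm Hs) φ → Prf T Δ Hs (l∀s φ)
  ∀se  : ∀ {Δ Hs φ} → Prf T Δ Hs (l∀s φ) → (X : Var Δ set) → Prf T Δ Hs (φ [ X ]ˢ)
  ≈refl  : ∀ {Δ Hs} (t : LTm Δ) → Prf T Δ Hs (t l≈ t)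
  ≈subst : ∀ {Δ Hs s t} (φ : LFm (num ∷ Δ)) →
           Prf T Δ Hs (s l≈ t) → Prf T Δ Hs (φ [ s ]ⁿ) → Prf T Δ Hs (φ [ t ]ⁿ)

_⊢ᴬ[_]_ : Theory → (Δ : SCtx) → LFm Δ → Set
T ⊢ᴬ[ Δ ] φ = Prf T Δ [] φ

-- PART II.  The logic-enriched type theory: raw syntax (de Bruijn,
-- unscoped; scoping is enforced by the judgements).

mutual
  data Ty : Set where
    tℕ   : Ty
    _t×_ : Ty → Ty → Ty
    _t⇒_ : Ty → Ty → Ty
    tU   : Ty
    tT   : Tm → Ty
    tSet : Ty → Ty

  data Tm : Set where
    var   : ℕ → Tm
    z0    : Tm
    zs    : Tm → Tm
    -- E_ℕ([x]C, L, [x,y]M, N): C binds 1 variable, M binds 2 (x outer, y inner)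
    zE    : Ty → Tm → Tm → Tm → Tm
    zpair : Ty → Ty → Tm → Tm → Tm
    zπ₁   : Ty → Ty → Tm → Tm
    zπ₂   : Ty → Ty → Tm → Tm
    -- λx:A.M:B  (M binds 1)
    zλ    : Ty → Tm → Ty → Tm
    zapp  : Ty → Ty → Tm → Tm → Tm
    zℕ̂    : Tm
    _z×̂_  : Tm → Tm → Tm
    -- {x:A | P}  (P binds 1)
    zset  : Ty → SP → Tm

  -- names of small propositions
  data SP : Set where
    -- M =̂_K N  written  pEq K M N
    pEq  : Tm → Tm → Tm → SP
    p⊥   : SP
    _p⊃_ : SP → SP → SP
    -- ∀̂x:M.P  (P binds 1)
    p∀   : Tm → SP → SP
    p∈   : Ty → Tm → Tm → SP

  data Pr : Set where
    -- M =_K N  written  fEq K M N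
    fEq  : Tm → Tm → Tm → Pr
    f⊥   : Pr
    _f⊃_ : Pr → Pr → Pr
    -- ∀x:A.φ (φ binds 1)
    f∀   : Ty → Pr → Pr
    fV   : SP → Pr

f¬ : Pr → Pr
f¬ φ = φ f⊃ f⊥

p¬ : SP → SP
p¬ P = P p⊃ p⊥

liftR : (ℕ → ℕ) → ℕ → ℕ
liftR ρ zero    = zero
liftR ρ (suc n) = suc (ρ n)

mutual
  renTy : (ℕ → ℕ) → Ty → Ty
  renTy ρ tℕ         = tℕ
  renTy ρ (A t× B)   = renTy ρ A t× renTy ρ B
  renTy ρ (A t⇒ B)   = renTy ρ A t⇒ renTy ρ B
  renTy ρ tU         = tU
  renTy ρ (tT M)     = tT (renTm ρ M)
  renTy ρ (tSet A)   = tSet (renTy ρ A)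

  renTm : (ℕ → ℕ) → Tm → Tm
  renTm ρ (var n)         = var (ρ n)
  renTm ρ z0              = z0
  renTm ρ (zs M)          = zs (renTm ρ M)
  renTm ρ (zE C L M N)    = zE (renTy (liftR ρ) C) (renTm ρ L) (renTm (liftR (liftR ρ)) M) (renTm ρ N)
  renTm ρ (zpair A B M N) = zpair (renTy ρ A) (renTy ρ B) (renTm ρ M) (renTm ρ N)
  renTm ρ (zπ₁ A B M)     = zπ₁ (renTy ρ A) (renTy ρ B) (renTm ρ M)
  renTm ρ (zπ₂ A B M)     = zπ₂ (renTy ρ A) (renTy ρ B) (renTm ρ M)
  renTm ρ (zλ A M B)      = zλ (renTy ρ A) (renTm (liftR ρ) M) (renTy ρ B)
  renTm ρ (zapp A B M N)  = zapp (renTy ρ A) (renTy ρ B) (renTm ρ M) (renTm ρ N)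
  renTm ρ zℕ̂              = zℕ̂
  renTm ρ (M z×̂ N)        = renTm ρ M z×̂ renTm ρ N
  renTm ρ (zset A P)      = zset (renTy ρ A) (renSP (liftR ρ) P)

  renSP : (ℕ → ℕ) → SP → SP
  renSP ρ (pEq K M N) = pEq (renTm ρ K) (renTm ρ M) (renTm ρ N)
  renSP ρ p⊥          = p⊥
  renSP ρ (P p⊃ Q)    = renSP ρ P p⊃ renSP ρ Q
  renSP ρ (p∀ M P)    = p∀ (renTm ρ M) (renSP (liftR ρ) P)
  renSP ρ (p∈ A M N)  = p∈ (renTy ρ A) (renTm ρ M) (renTm ρ N)

  renPr : (ℕ → ℕ) → Pr → Pr
  renPr ρ (fEq K M N) = fEq (renTm ρ K) (renTm ρ M) (renTm ρ N)
  renPr ρ f⊥          = f⊥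
  renPr ρ (φ f⊃ ψ)    = renPr ρ φ f⊃ renPr ρ ψ
  renPr ρ (f∀ A φ)    = f∀ (renTy ρ A) (renPr (liftR ρ) φ)
  renPr ρ (fV P)      = fV (renSP ρ P)

wkTy : Ty → Ty
wkTy = renTy suc

wkTm : Tm → Tm
wkTm = renTm suc

wkPr : Pr → Pr
wkPr = renPr suc

liftS : (ℕ → Tm) → ℕ → Tm
liftS σ zero    = var zero
liftS σ (suc n) = wkTm (σ n)

mutual
  subTy : (ℕ → Tm) → Ty → Ty
  subTy σ tℕ         = tℕ
  subTy σ (A t× B)   = subTy σ A t× subTy σ B
  subTy σ (A t⇒ B)   = subTy σ A t⇒ subTy σ B
  subTy σ tU         = tU
  subTy σ (tT M)     = tT (subTm σ M)
  subTy σ (tSet A)   = tSet (subTy σ A)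

  subTm : (ℕ → Tm) → Tm → Tm
  subTm σ (var n)         = σ n
  subTm σ z0              = z0
  subTm σ (zs M)          = zs (subTm σ M)
  subTm σ (zE C L M N)    = zE (subTy (liftS σ) C) (subTm σ L) (subTm (liftS (liftS σ)) M) (subTm σ N)
  subTm σ (zpair A B M N) = zpair (subTy σ A) (subTy σ B) (subTm σ M) (subTm σ N)
  subTm σ (zπ₁ A B M)     = zπ₁ (subTy σ A) (subTy σ B) (subTm σ M)
  subTm σ (zπ₂ A B M)     = zπ₂ (subTy σ A) (subTy σ B) (subTm σ M)
  subTm σ (zλ A M B)      = zλ (subTy σ A) (subTm (liftS σ) M) (subTy σ B)
  subTm σ (zapp A B M N)  = zapp (subTy σ A) (subTy σ B) (subTm σ M) (subTm σ N)
  subTm σ zℕ̂              = zℕ̂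
  subTm σ (M z×̂ N)        = subTm σ M z×̂ subTm σ N
  subTm σ (zset A P)      = zset (subTy σ A) (subSP (liftS σ) P)

  subSP : (ℕ → Tm) → SP → SP
  subSP σ (pEq K M N) = pEq (subTm σ K) (subTm σ M) (subTm σ N)
  subSP σ p⊥          = p⊥
  subSP σ (P p⊃ Q)    = subSP σ P p⊃ subSP σ Q
  subSP σ (p∀ M P)    = p∀ (subTm σ M) (subSP (liftS σ) P)
  subSP σ (p∈ A M N)  = p∈ (subTy σ A) (subTm σ M) (subTm σ N)

  subPr : (ℕ → Tm) → Pr → Pr
  subPr σ (fEq K M N) = fEq (subTm σ K) (subTm σ M) (subTm σ N)
  subPr σ f⊥          = f⊥
  subPr σ (φ f⊃ ψ)    = subPr σ φ f⊃ subPr σ ψ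
  subPr σ (f∀ A φ)    = f∀ (subTy σ A) (subPr (liftS σ) φ)
  subPr σ (fV P)      = fV (subSP σ P)

σ₁ : Tm → ℕ → Tm
σ₁ N zero    = N
σ₁ N (suc n) = var n

-- [N/x, E/y] for the two innermost variables x (index 1), y (index 0)
σ₂ : Tm → Tm → ℕ → Tm
σ₂ N E zero          = E
σ₂ N E (suc zero)    = N
σ₂ N E (suc (suc n)) = var n

-- [s x/x] for C in Γ,x:ℕ, read in Γ,x:ℕ,y:C
σsuc₂ : ℕ → Tm
σsuc₂ zero    = zs (var (suc zero))
σsuc₂ (suc n) = var (suc (suc n))

σsuc₁ : ℕ → Tm
σsuc₁ zero    = zs (var zero)
σsuc₁ (suc n) = var (suc n)

mutual
  hasUTy : Ty → Bool
  hasUTy tℕ       = false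
  hasUTy (A t× B) = hasUTy A ∨ hasUTy B
  hasUTy (A t⇒ B) = hasUTy A ∨ hasUTy B
  hasUTy tU       = true
  hasUTy (tT M)   = hasUTm M
  hasUTy (tSet A) = hasUTy A

  hasUTm : Tm → Bool
  hasUTm (var n)         = false
  hasUTm z0              = false
  hasUTm (zs M)          = hasUTm M
  hasUTm (zE C L M N)    = hasUTy C ∨ (hasUTm L ∨ (hasUTm M ∨ hasUTm N))
  hasUTm (zpair A B M N) = hasUTy A ∨ (hasUTy B ∨ (hasUTm M ∨ hasUTm N))
  hasUTm (zπ₁ A B M)     = hasUTy A ∨ (hasUTy B ∨ hasUTm M)
  hasUTm (zπ₂ A B M)     = hasUTy A ∨ (hasUTy B ∨ hasUTm M)
  hasUTm (zλ A M B)      = hasUTy A ∨ (hasUTm M ∨ hasUTy B)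
  hasUTm (zapp A B M N)  = hasUTy A ∨ (hasUTy B ∨ (hasUTm M ∨ hasUTm N))
  hasUTm zℕ̂              = false
  hasUTm (M z×̂ N)        = hasUTm M ∨ hasUTm N
  hasUTm (zset A P)      = hasUTy A ∨ hasUSP P

  hasUSP : SP → Bool
  hasUSP (pEq K M N) = hasUTm K ∨ (hasUTm M ∨ hasUTm N)
  hasUSP p⊥          = false
  hasUSP (P p⊃ Q)    = hasUSP P ∨ hasUSP Q
  hasUSP (p∀ M P)    = hasUTm M ∨ hasUSP P
  hasUSP (p∈ A M N)  = hasUTy A ∨ (hasUTm M ∨ hasUTm N)

data NoUQuant : Pr → Set where
  nuEq : ∀ {K M N} → NoUQuant (fEq K M N)
  nu⊥  : NoUQuant f⊥
  nu⊃  : ∀ {φ ψ} → NoUQuant φ → NoUQuant ψ → NoUQuant (φ f⊃ ψ)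
  nu∀  : ∀ {A φ} → hasUTy A ≡ false → NoUQuant φ → NoUQuant (f∀ A φ)
  nuV  : ∀ {P} → NoUQuant (fV P)

data Analytic : Pr → Set where
  anEq : ∀ {K M N} → Analytic (fEq K M N)
  an⊥  : Analytic f⊥
  an⊃  : ∀ {φ ψ} → Analytic φ → Analytic ψ → Analytic (φ f⊃ ψ)
  an∀T : ∀ {M φ} → Analytic φ → Analytic (f∀ (tT M) φ)
  an∀S : ∀ {φ} → Analytic φ → Analytic (f∀ (tSet tℕ) φ)
  anV  : ∀ {P} → Analytic (fV P)

data IsT : Ty → Set where
  isT : ∀ {K} → IsT (tT K)

data IsV : Pr → Set where
  isV : ∀ {P} → IsV (fV P)

data Sys : Set where
  LTTW LTT0 LTT0* : Sys

ENOk : Sys → Ty → Set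
ENOk LTTW  C = ⊤
ENOk LTT0  C = IsT C
ENOk LTT0* C = IsT C

IndOk : Sys → Pr → Set
IndOk LTTW  φ = ⊤
IndOk LTT0  φ = IsV φ
IndOk LTT0* φ = Analytic φ

SubstOk : Sys → Pr → Set
SubstOk LTTW  φ = ⊤
SubstOk LTT0  φ = NoUQuant φ
SubstOk LTT0* φ = NoUQuant φ

ZeroOk : Sys → Set
ZeroOk LTTW  = ⊥
ZeroOk LTT0  = ⊤
ZeroOk LTT0* = ⊤

-- contexts: innermost declaration first
Ctx : Set
Ctx = List Ty

data Lookup : Ctx → ℕ → Ty → Set where
  here  : ∀ {Γ A} → Lookup (A ∷ Γ) zero (wkTy A)
  there : ∀ {Γ A B i} → Lookup Γ i A → Lookup (B ∷ Γ) (suc i) (wkTy A)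

data Judg : Set where
  valid   : Judg
  isType  : Ty → Judg
  tyEq    : Ty → Ty → Judg
  hasTy   : Tm → Ty → Judg
  tmEq    : Tm → Tm → Ty → Judg
  isSP    : SP → Judg
  spEq    : SP → SP → Judg
  isPr    : Pr → Judg
  prEq    : Pr → Pr → Judg
  entails : List Pr → Pr → Judg

infix 3 _▷_⊢_

data _▷_⊢_ (S : Sys) : Ctx → Judg → Set where
  ctxEmpty : S ▷ [] ⊢ valid
  ctxExt   : ∀ {Γ A} → S ▷ Γ ⊢ isType A → S ▷ (A ∷ Γ) ⊢ valid
  varR     : ∀ {Γ i A} → S ▷ Γ ⊢ valid → Lookup Γ i A → S ▷ Γ ⊢ hasTy (var i) A
  tyRefl   : ∀ {Γ A} → S ▷ Γ ⊢ isType A → S ▷ Γ ⊢ tyEq A A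
  tySym    : ∀ {Γ A B} → S ▷ Γ ⊢ tyEq A B → S ▷ Γ ⊢ tyEq B A
  tyTrans  : ∀ {Γ A B C} → S ▷ Γ ⊢ tyEq A B → S ▷ Γ ⊢ tyEq B C → S ▷ Γ ⊢ tyEq A C
  tmRefl   : ∀ {Γ M A} → S ▷ Γ ⊢ hasTy M A → S ▷ Γ ⊢ tmEq M M A
  tmSym    : ∀ {Γ M N A} → S ▷ Γ ⊢ tmEq M N A → S ▷ Γ ⊢ tmEq N M A
  tmTrans  : ∀ {Γ M N K A} → S ▷ Γ ⊢ tmEq M N A → S ▷ Γ ⊢ tmEq N K A → S ▷ Γ ⊢ tmEq M K A
  spRefl   : ∀ {Γ P} → S ▷ Γ ⊢ isSP P → S ▷ Γ ⊢ spEq P P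
  spSym    : ∀ {Γ P Q} → S ▷ Γ ⊢ spEq P Q → S ▷ Γ ⊢ spEq Q P
  spTrans  : ∀ {Γ P Q R} → S ▷ Γ ⊢ spEq P Q → S ▷ Γ ⊢ spEq Q R → S ▷ Γ ⊢ spEq P R
  prRefl   : ∀ {Γ φ} → S ▷ Γ ⊢ isPr φ → S ▷ Γ ⊢ prEq φ φ
  prSym    : ∀ {Γ φ ψ} → S ▷ Γ ⊢ prEq φ ψ → S ▷ Γ ⊢ prEq ψ φ
  prTrans  : ∀ {Γ φ ψ χ} → S ▷ Γ ⊢ prEq φ ψ → S ▷ Γ ⊢ prEq ψ χ → S ▷ Γ ⊢ prEq φ χ
  convTm   : ∀ {Γ M A B} → S ▷ Γ ⊢ hasTy M A → S ▷ Γ ⊢ tyEq A B → S ▷ Γ ⊢ hasTy M B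
  convTmEq : ∀ {Γ M N A B} → S ▷ Γ ⊢ tmEq M N A → S ▷ Γ ⊢ tyEq A B → S ▷ Γ ⊢ tmEq M N B
  assum    : ∀ {Γ Φ φ} → All (λ ψ → S ▷ Γ ⊢ isPr ψ) Φ → φ ∈ Φ → S ▷ Γ ⊢ entails Φ φ
  convEnt  : ∀ {Γ Φ φ ψ} → S ▷ Γ ⊢ entails Φ φ → S ▷ Γ ⊢ prEq φ ψ → S ▷ Γ ⊢ entails Φ ψ

  ℕF     : ∀ {Γ} → S ▷ Γ ⊢ valid → S ▷ Γ ⊢ isType tℕ
  ×F     : ∀ {Γ A B} → S ▷ Γ ⊢ isType A → S ▷ Γ ⊢ isType B → S ▷ Γ ⊢ isType (A t× B)
  ⇒F     : ∀ {Γ A B} → S ▷ Γ ⊢ isType A → S ▷ Γ ⊢ isType B → S ▷ Γ ⊢ isType (A t⇒ B)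
  UF     : ∀ {Γ} → S ▷ Γ ⊢ valid → S ▷ Γ ⊢ isType tU
  TF     : ∀ {Γ M} → S ▷ Γ ⊢ hasTy M tU → S ▷ Γ ⊢ isType (tT M)
  SetF   : ∀ {Γ A} → S ▷ Γ ⊢ isType A → S ▷ Γ ⊢ isType (tSet A)
  ×Cong  : ∀ {Γ A A' B B'} → S ▷ Γ ⊢ tyEq A A' → S ▷ Γ ⊢ tyEq B B' → S ▷ Γ ⊢ tyEq (A t× B) (A' t× B')
  ⇒Cong  : ∀ {Γ A A' B B'} → S ▷ Γ ⊢ tyEq A A' → S ▷ Γ ⊢ tyEq B B' → S ▷ Γ ⊢ tyEq (A t⇒ B) (A' t⇒ B')
  TCong  : ∀ {Γ M N} → S ▷ Γ ⊢ tmEq M N tU → S ▷ Γ ⊢ tyEq (tT M) (tT N)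
  SetCong : ∀ {Γ A A'} → S ▷ Γ ⊢ tyEq A A' → S ▷ Γ ⊢ tyEq (tSet A) (tSet A')
  Tℕ̂     : ∀ {Γ} → S ▷ Γ ⊢ valid → S ▷ Γ ⊢ tyEq (tT zℕ̂) tℕ
  T×̂     : ∀ {Γ M N} → S ▷ Γ ⊢ hasTy M tU → S ▷ Γ ⊢ hasTy N tU →
           S ▷ Γ ⊢ tyEq (tT (M z×̂ N)) (tT M t× tT N)

  0I     : ∀ {Γ} → S ▷ Γ ⊢ valid → S ▷ Γ ⊢ hasTy z0 tℕ
  sI     : ∀ {Γ M} → S ▷ Γ ⊢ hasTy M tℕ → S ▷ Γ ⊢ hasTy (zs M) tℕ
  sCong  : ∀ {Γ M N} → S ▷ Γ ⊢ tmEq M N tℕ → S ▷ Γ ⊢ tmEq (zs M) (zs N) tℕ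
  EI     : ∀ {Γ C L M N} → ENOk S C →
           S ▷ (tℕ ∷ Γ) ⊢ isType C →
           S ▷ Γ ⊢ hasTy L (subTy (σ₁ z0) C) →
           S ▷ (C ∷ tℕ ∷ Γ) ⊢ hasTy M (subTy σsuc₂ C) →
           S ▷ Γ ⊢ hasTy N tℕ →
           S ▷ Γ ⊢ hasTy (zE C L M N) (subTy (σ₁ N) C)
  E0     : ∀ {Γ C L M} → ENOk S C →
           S ▷ (tℕ ∷ Γ) ⊢ isType C →
           S ▷ Γ ⊢ hasTy L (subTy (σ₁ z0) C) →
           S ▷ (C ∷ tℕ ∷ Γ) ⊢ hasTy M (subTy σsuc₂ C) →
           S ▷ Γ ⊢ tmEq (zE C L M z0) L (subTy (σ₁ z0) C)
  Es     : ∀ {Γ C L M N} → ENOk S C →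
           S ▷ (tℕ ∷ Γ) ⊢ isType C →
           S ▷ Γ ⊢ hasTy L (subTy (σ₁ z0) C) →
           S ▷ (C ∷ tℕ ∷ Γ) ⊢ hasTy M (subTy σsuc₂ C) →
           S ▷ Γ ⊢ hasTy N tℕ →
           S ▷ Γ ⊢ tmEq (zE C L M (zs N)) (subTm (σ₂ N (zE C L M N)) M) (subTy (σ₁ (zs N)) C)
  ECong  : ∀ {Γ C C' L L' M M' N N'} → ENOk S C → ENOk S C' →
           S ▷ (tℕ ∷ Γ) ⊢ tyEq C C' →
           S ▷ Γ ⊢ tmEq L L' (subTy (σ₁ z0) C) →
           S ▷ (C ∷ tℕ ∷ Γ) ⊢ tmEq M M' (subTy σsuc₂ C) →
           S ▷ Γ ⊢ tmEq N N' tℕ →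
           S ▷ Γ ⊢ tmEq (zE C L M N) (zE C' L' M' N') (subTy (σ₁ N) C)

  pairI  : ∀ {Γ A B M N} → S ▷ Γ ⊢ hasTy M A → S ▷ Γ ⊢ hasTy N B →
           S ▷ Γ ⊢ hasTy (zpair A B M N) (A t× B)
  pairCong : ∀ {Γ A A' B B' M M' N N'} → S ▷ Γ ⊢ tyEq A A' → S ▷ Γ ⊢ tyEq B B' →
           S ▷ Γ ⊢ tmEq M M' A → S ▷ Γ ⊢ tmEq N N' B →
           S ▷ Γ ⊢ tmEq (zpair A B M N) (zpair A' B' M' N') (A t× B)
  π₁I    : ∀ {Γ A B M} → S ▷ Γ ⊢ hasTy M (A t× B) → S ▷ Γ ⊢ hasTy (zπ₁ A B M) A
  π₂I    : ∀ {Γ A B M} → S ▷ Γ ⊢ hasTy M (A t× B) → S ▷ Γ ⊢ hasTy (zπ₂ A B M) B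
  π₁Cong : ∀ {Γ A A' B B' M M'} → S ▷ Γ ⊢ tyEq A A' → S ▷ Γ ⊢ tyEq B B' →
           S ▷ Γ ⊢ tmEq M M' (A t× B) → S ▷ Γ ⊢ tmEq (zπ₁ A B M) (zπ₁ A' B' M') A
  π₂Cong : ∀ {Γ A A' B B' M M'} → S ▷ Γ ⊢ tyEq A A' → S ▷ Γ ⊢ tyEq B B' →
           S ▷ Γ ⊢ tmEq M M' (A t× B) → S ▷ Γ ⊢ tmEq (zπ₂ A B M) (zπ₂ A' B' M') B
  π₁β    : ∀ {Γ A B M₁ M₂} → S ▷ Γ ⊢ hasTy M₁ A → S ▷ Γ ⊢ hasTy M₂ B →
           S ▷ Γ ⊢ tmEq (zπ₁ A B (zpair A B M₁ M₂)) M₁ A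
  π₂β    : ∀ {Γ A B M₁ M₂} → S ▷ Γ ⊢ hasTy M₁ A → S ▷ Γ ⊢ hasTy M₂ B →
           S ▷ Γ ⊢ tmEq (zπ₂ A B (zpair A B M₁ M₂)) M₂ B

  λI     : ∀ {Γ A M B} → S ▷ (A ∷ Γ) ⊢ hasTy M (wkTy B) →
           S ▷ Γ ⊢ hasTy (zλ A M B) (A t⇒ B)
  λCong  : ∀ {Γ A A' M M' B B'} → S ▷ Γ ⊢ tyEq A A' → S ▷ Γ ⊢ tyEq B B' →
           S ▷ (A ∷ Γ) ⊢ tmEq M M' (wkTy B) →
           S ▷ Γ ⊢ tmEq (zλ A M B) (zλ A' M' B') (A t⇒ B)
  appI   : ∀ {Γ A B M N} → S ▷ Γ ⊢ hasTy M (A t⇒ B) → S ▷ Γ ⊢ hasTy N A →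
           S ▷ Γ ⊢ hasTy (zapp A B M N) B
  appCong : ∀ {Γ A A' B B' M M' N N'} → S ▷ Γ ⊢ tyEq A A' → S ▷ Γ ⊢ tyEq B B' →
           S ▷ Γ ⊢ tmEq M M' (A t⇒ B) → S ▷ Γ ⊢ tmEq N N' A →
           S ▷ Γ ⊢ tmEq (zapp A B M N) (zapp A' B' M' N') B
  β      : ∀ {Γ A M B N} → S ▷ (A ∷ Γ) ⊢ hasTy M (wkTy B) → S ▷ Γ ⊢ hasTy N A →
           S ▷ Γ ⊢ tmEq (zapp A B (zλ A M B) N) (subTm (σ₁ N) M) B

  ℕ̂I     : ∀ {Γ} → S ▷ Γ ⊢ valid → S ▷ Γ ⊢ hasTy zℕ̂ tU
  ×̂I     : ∀ {Γ M N} → S ▷ Γ ⊢ hasTy M tU → S ▷ Γ ⊢ hasTy N tU → S ▷ Γ ⊢ hasTy (M z×̂ N) tU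
  ×̂Cong  : ∀ {Γ M M' N N'} → S ▷ Γ ⊢ tmEq M M' tU → S ▷ Γ ⊢ tmEq N N' tU →
           S ▷ Γ ⊢ tmEq (M z×̂ N) (M' z×̂ N') tU

  setI   : ∀ {Γ A P} → S ▷ (A ∷ Γ) ⊢ isSP P → S ▷ Γ ⊢ hasTy (zset A P) (tSet A)
  setCong : ∀ {Γ A A' P P'} → S ▷ Γ ⊢ tyEq A A' → S ▷ (A ∷ Γ) ⊢ spEq P P' →
           S ▷ Γ ⊢ tmEq (zset A P) (zset A' P') (tSet A)
  ∈̂F     : ∀ {Γ A M N} → S ▷ Γ ⊢ hasTy M A → S ▷ Γ ⊢ hasTy N (tSet A) → S ▷ Γ ⊢ isSP (p∈ A M N)
  ∈̂Cong  : ∀ {Γ A A' M M' N N'} → S ▷ Γ ⊢ tyEq A A' → S ▷ Γ ⊢ tmEq M M' A →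
           S ▷ Γ ⊢ tmEq N N' (tSet A) → S ▷ Γ ⊢ spEq (p∈ A M N) (p∈ A' M' N')
  ∈̂β     : ∀ {Γ A M P} → S ▷ Γ ⊢ hasTy M A → S ▷ (A ∷ Γ) ⊢ isSP P →
           S ▷ Γ ⊢ spEq (p∈ A M (zset A P)) (subSP (σ₁ M) P)

  =̂F     : ∀ {Γ K M₁ M₂} → S ▷ Γ ⊢ hasTy K tU → S ▷ Γ ⊢ hasTy M₁ (tT K) → S ▷ Γ ⊢ hasTy M₂ (tT K) →
           S ▷ Γ ⊢ isSP (pEq K M₁ M₂)
  =̂Cong  : ∀ {Γ K K' M₁ M₁' M₂ M₂'} → S ▷ Γ ⊢ tmEq K K' tU →
           S ▷ Γ ⊢ tmEq M₁ M₁' (tT K) → S ▷ Γ ⊢ tmEq M₂ M₂' (tT K) →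
           S ▷ Γ ⊢ spEq (pEq K M₁ M₂) (pEq K' M₁' M₂')
  ⊥̂F     : ∀ {Γ} → S ▷ Γ ⊢ valid → S ▷ Γ ⊢ isSP p⊥
  ⊃̂F     : ∀ {Γ P Q} → S ▷ Γ ⊢ isSP P → S ▷ Γ ⊢ isSP Q → S ▷ Γ ⊢ isSP (P p⊃ Q)
  ⊃̂Cong  : ∀ {Γ P P' Q Q'} → S ▷ Γ ⊢ spEq P P' → S ▷ Γ ⊢ spEq Q Q' →
           S ▷ Γ ⊢ spEq (P p⊃ Q) (P' p⊃ Q')
  ∀̂F     : ∀ {Γ M P} → S ▷ Γ ⊢ hasTy M tU → S ▷ (tT M ∷ Γ) ⊢ isSP P → S ▷ Γ ⊢ isSP (p∀ M P)
  ∀̂Cong  : ∀ {Γ M M' P P'} → S ▷ Γ ⊢ tmEq M M' tU → S ▷ (tT M ∷ Γ) ⊢ spEq P P' →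
           S ▷ Γ ⊢ spEq (p∀ M P) (p∀ M' P')

  =F     : ∀ {Γ K M₁ M₂} → S ▷ Γ ⊢ hasTy K tU → S ▷ Γ ⊢ hasTy M₁ (tT K) → S ▷ Γ ⊢ hasTy M₂ (tT K) →
           S ▷ Γ ⊢ isPr (fEq K M₁ M₂)
  =Cong  : ∀ {Γ K K' M₁ M₁' M₂ M₂'} → S ▷ Γ ⊢ tmEq K K' tU →
           S ▷ Γ ⊢ tmEq M₁ M₁' (tT K) → S ▷ Γ ⊢ tmEq M₂ M₂' (tT K) →
           S ▷ Γ ⊢ prEq (fEq K M₁ M₂) (fEq K' M₁' M₂')
  ⊥F     : ∀ {Γ} → S ▷ Γ ⊢ valid → S ▷ Γ ⊢ isPr f⊥
  ⊃F     : ∀ {Γ φ ψ} → S ▷ Γ ⊢ isPr φ → S ▷ Γ ⊢ isPr ψ → S ▷ Γ ⊢ isPr (φ f⊃ ψ)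
  ⊃Cong  : ∀ {Γ φ φ' ψ ψ'} → S ▷ Γ ⊢ prEq φ φ' → S ▷ Γ ⊢ prEq ψ ψ' →
           S ▷ Γ ⊢ prEq (φ f⊃ ψ) (φ' f⊃ ψ')
  ∀F     : ∀ {Γ A φ} → S ▷ (A ∷ Γ) ⊢ isPr φ → S ▷ Γ ⊢ isPr (f∀ A φ)
  ∀Cong  : ∀ {Γ A A' φ φ'} → S ▷ Γ ⊢ tyEq A A' → S ▷ (A ∷ Γ) ⊢ prEq φ φ' →
           S ▷ Γ ⊢ prEq (f∀ A φ) (f∀ A' φ')
  VF     : ∀ {Γ P} → S ▷ Γ ⊢ isSP P → S ▷ Γ ⊢ isPr (fV P)
  VCong  : ∀ {Γ P Q} → S ▷ Γ ⊢ spEq P Q → S ▷ Γ ⊢ prEq (fV P) (fV Q)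
  V⊥     : ∀ {Γ} → S ▷ Γ ⊢ valid → S ▷ Γ ⊢ prEq (fV p⊥) f⊥
  V⊃     : ∀ {Γ P Q} → S ▷ Γ ⊢ isSP P → S ▷ Γ ⊢ isSP Q →
           S ▷ Γ ⊢ prEq (fV (P p⊃ Q)) (fV P f⊃ fV Q)
  V∀     : ∀ {Γ M P} → S ▷ Γ ⊢ hasTy M tU → S ▷ (tT M ∷ Γ) ⊢ isSP P →
           S ▷ Γ ⊢ prEq (fV (p∀ M P)) (f∀ (tT M) (fV P))
  V=     : ∀ {Γ K M₁ M₂} → S ▷ Γ ⊢ hasTy K tU → S ▷ Γ ⊢ hasTy M₁ (tT K) → S ▷ Γ ⊢ hasTy M₂ (tT K) →
           S ▷ Γ ⊢ prEq (fV (pEq K M₁ M₂)) (fEq K M₁ M₂)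

  ⊥E     : ∀ {Γ Φ φ} → S ▷ Γ ⊢ entails Φ f⊥ → S ▷ Γ ⊢ isPr φ → S ▷ Γ ⊢ entails Φ φ
  ⊃I     : ∀ {Γ Φ φ ψ} → S ▷ Γ ⊢ entails (φ ∷ Φ) ψ → S ▷ Γ ⊢ entails Φ (φ f⊃ ψ)
  ⊃E     : ∀ {Γ Φ φ ψ} → S ▷ Γ ⊢ entails Φ (φ f⊃ ψ) → S ▷ Γ ⊢ entails Φ φ → S ▷ Γ ⊢ entails Φ ψ
  DNE    : ∀ {Γ Φ φ} → S ▷ Γ ⊢ entails Φ (f¬ (f¬ φ)) → S ▷ Γ ⊢ entails Φ φ
  ∀I     : ∀ {Γ Φ A φ} → S ▷ (A ∷ Γ) ⊢ entails (map wkPr Φ) φ → S ▷ Γ ⊢ entails Φ (f∀ A φ)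
  ∀E     : ∀ {Γ Φ A φ N} → S ▷ Γ ⊢ entails Φ (f∀ A φ) → S ▷ Γ ⊢ hasTy N A →
           S ▷ Γ ⊢ entails Φ (subPr (σ₁ N) φ)

  =refl  : ∀ {Γ Φ M N} → All (λ ψ → S ▷ Γ ⊢ isPr ψ) Φ → S ▷ Γ ⊢ hasTy M (tT N) →
           S ▷ Γ ⊢ entails Φ (fEq N M M)
  =subst : ∀ {Γ Φ N M₁ M₂ φ} → SubstOk S φ →
           S ▷ (tT N ∷ Γ) ⊢ isPr φ →
           S ▷ Γ ⊢ entails Φ (fEq N M₁ M₂) →
           S ▷ Γ ⊢ entails Φ (subPr (σ₁ M₁) φ) →
           S ▷ Γ ⊢ entails Φ (subPr (σ₁ M₂) φ)

  eta× : ∀ {Γ Φ A B M φ} → SubstOk S φ → S ▷ Γ ⊢ hasTy M (A t× B) →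
         S ▷ Γ ⊢ entails Φ (subPr (σ₁ (zpair A B (zπ₁ A B M) (zπ₂ A B M))) φ) →
         S ▷ Γ ⊢ entails Φ (subPr (σ₁ M) φ)
  eta⇒ : ∀ {Γ Φ A B M φ} → SubstOk S φ → S ▷ Γ ⊢ hasTy M (A t⇒ B) →
         S ▷ Γ ⊢ entails Φ (subPr (σ₁ (zλ A (zapp A B (wkTm M) (var zero)) B)) φ) →
         S ▷ Γ ⊢ entails Φ (subPr (σ₁ M) φ)

  indℕ : ∀ {Γ Φ N φ} → IndOk S φ →
         S ▷ (tℕ ∷ Γ) ⊢ isPr φ →
         S ▷ Γ ⊢ hasTy N tℕ →
         S ▷ Γ ⊢ entails Φ (subPr (σ₁ z0) φ) →
         S ▷ (tℕ ∷ Γ) ⊢ entails (φ ∷ map wkPr Φ) (subPr σsuc₁ φ) →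
         S ▷ Γ ⊢ entails Φ (subPr (σ₁ N) φ)

  zeroNotSuc : ∀ {Γ Φ M} → ZeroOk S → All (λ ψ → S ▷ Γ ⊢ isPr ψ) Φ →
               S ▷ Γ ⊢ hasTy M tℕ → S ▷ Γ ⊢ entails Φ (f¬ (fEq zℕ̂ z0 (zs M)))

_plus_ : Tm → Tm → Tm
M plus N = zE (tT zℕ̂) M (zs (var zero)) N

_times_ : Tm → Tm → Tm
M times N = zE (tT zℕ̂) z0 (var zero plus renTm (λ k → suc (suc k)) M) N

⟨_⟩ᵗ : ∀ {Δ} → LTm Δ → Tm
⟨ lv x ⟩ᵗ   = var (varIdx x)
⟨ lO ⟩ᵗ     = z0
⟨ lS t ⟩ᵗ   = zs ⟨ t ⟩ᵗ
⟨ s l+ t ⟩ᵗ = ⟨ s ⟩ᵗ plus ⟨ t ⟩ᵗ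
⟨ s l· t ⟩ᵗ = ⟨ s ⟩ᵗ times ⟨ t ⟩ᵗ

⟪_⟫ : ∀ {Δ} {φ : LFm Δ} → Arith φ → SP
⟪ a≈ {s} {t} ⟫ = pEq zℕ̂ ⟨ s ⟩ᵗ ⟨ t ⟩ᵗ
⟪ a∈ {t} {X} ⟫ = p∈ tℕ ⟨ t ⟩ᵗ (var (varIdx X))
⟪ a⊥ ⟫         = p⊥
⟪ a⊃ a b ⟫     = ⟪ a ⟫ p⊃ ⟪ b ⟫
⟪ a∀ a ⟫       = p∀ zℕ̂ ⟪ a ⟫

⟨_⟩ᶠ : ∀ {Δ} → LFm Δ → Pr
⟨ s l≈ t ⟩ᶠ = fEq zℕ̂ ⟨ s ⟩ᵗ ⟨ t ⟩ᵗ
⟨ t l∈ X ⟩ᶠ = fV (p∈ tℕ ⟨ t ⟩ᵗ (var (varIdx X)))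
⟨ l⊥ ⟩ᶠ     = f⊥
⟨ φ l⊃ ψ ⟩ᶠ = ⟨ φ ⟩ᶠ f⊃ ⟨ ψ ⟩ᶠ
⟨ l∀n φ ⟩ᶠ  = f∀ tℕ ⟨ φ ⟩ᶠ
⟨ l∀s φ ⟩ᶠ  = f∀ (tSet tℕ) ⟨ φ ⟩ᶠ

-- the contexts of the theorem:  x₁:ℕ,…,x_m:ℕ, X₁:Set(ℕ),…,X_n:Set(ℕ)
sortTy : Sort → Ty
sortTy num = tℕ
sortTy set = tSet tℕ

Δmn : ℕ → ℕ → SCtx
Δmn m n = replicate n set ++ replicate m num

Γmn : ℕ → ℕ → Ctx
Γmn m n = map sortTy (Δmn m n)

module Submission where

open import Defs
open import Data.Nat using (ℕ; zero; suc)
open import Data.List using (List; []; _∷_; map)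
open import Data.List.Membership.Propositional.Properties using (∈-map⁺)
open import Data.List.Relation.Unary.All using (All; []; _∷_)
open import Data.List.Relation.Unary.Any using (here; there)
open import Data.Product using (Σ; _,_; _×_)
open import Data.Unit using (⊤; tt)
open import Relation.Binary.PropositionalEquality

-- Statements (1) and (2) are typing facts, proved by induction on terms and
-- formulas in any context that realises the sort context of 𝓛: number
-- variables of type ℕ or T(ℕ̂), set variables of type Set(ℕ).  The arithmetic
-- axioms hold by computation of E_ℕ; comprehension is witnessed by the set
-- {x : ℕ | ⟪φ⟫}; set induction is (Ind_ℕ) for the small proposition x ∈ X; the
-- induction scheme of ACA is (Ind_ℕ) for the translation with number
-- quantifiers read over T(ℕ̂), which is analytic and judgementally equal to
-- the translation over ℕ.

cong₃ : ∀ {A B C D : Set} (f : A → B → C → D) {a a' b b' c c'} →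
        a ≡ a' → b ≡ b' → c ≡ c' → f a b c ≡ f a' b' c'
cong₃ f refl refl refl = refl

cong₄ : ∀ {A B C D E : Set} (f : A → B → C → D → E) {a a' b b' c c' d d'} →
        a ≡ a' → b ≡ b' → c ≡ c' → d ≡ d' → f a b c d ≡ f a' b' c' d'
cong₄ f refl refl refl refl = refl

liftR-∘ : ∀ {ρ ρ' ρ'' : ℕ → ℕ} → (∀ k → ρ (ρ' k) ≡ ρ'' k) →
          ∀ k → liftR ρ (liftR ρ' k) ≡ liftR ρ'' k
liftR-∘ h zero    = refl
liftR-∘ h (suc k) = cong suc (h k)

mutual
  ren-ren-Ty : ∀ {ρ ρ' ρ''} → (∀ k → ρ (ρ' k) ≡ ρ'' k) →
               (A : Ty) → renTy ρ (renTy ρ' A) ≡ renTy ρ'' A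
  ren-ren-Ty h tℕ       = refl
  ren-ren-Ty h (A t× B) = cong₂ _t×_ (ren-ren-Ty h A) (ren-ren-Ty h B)
  ren-ren-Ty h (A t⇒ B) = cong₂ _t⇒_ (ren-ren-Ty h A) (ren-ren-Ty h B)
  ren-ren-Ty h tU       = refl
  ren-ren-Ty h (tT M)   = cong tT (ren-ren-Tm h M)
  ren-ren-Ty h (tSet A) = cong tSet (ren-ren-Ty h A)

  ren-ren-Tm : ∀ {ρ ρ' ρ''} → (∀ k → ρ (ρ' k) ≡ ρ'' k) →
               (M : Tm) → renTm ρ (renTm ρ' M) ≡ renTm ρ'' M
  ren-ren-Tm h (var n)         = cong var (h n)
  ren-ren-Tm h z0              = refl
  ren-ren-Tm h (zs M)          = cong zs (ren-ren-Tm h M)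
  ren-ren-Tm h (zE C L M N)    = cong₄ zE (ren-ren-Ty (liftR-∘ h) C) (ren-ren-Tm h L)
                                   (ren-ren-Tm (liftR-∘ (liftR-∘ h)) M) (ren-ren-Tm h N)
  ren-ren-Tm h (zpair A B M N) = cong₄ zpair (ren-ren-Ty h A) (ren-ren-Ty h B) (ren-ren-Tm h M) (ren-ren-Tm h N)
  ren-ren-Tm h (zπ₁ A B M)     = cong₃ zπ₁ (ren-ren-Ty h A) (ren-ren-Ty h B) (ren-ren-Tm h M)
  ren-ren-Tm h (zπ₂ A B M)     = cong₃ zπ₂ (ren-ren-Ty h A) (ren-ren-Ty h B) (ren-ren-Tm h M)
  ren-ren-Tm h (zλ A M B)      = cong₃ zλ (ren-ren-Ty h A) (ren-ren-Tm (liftR-∘ h) M) (ren-ren-Ty h B)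
  ren-ren-Tm h (zapp A B M N)  = cong₄ zapp (ren-ren-Ty h A) (ren-ren-Ty h B) (ren-ren-Tm h M) (ren-ren-Tm h N)
  ren-ren-Tm h zℕ̂              = refl
  ren-ren-Tm h (M z×̂ N)        = cong₂ _z×̂_ (ren-ren-Tm h M) (ren-ren-Tm h N)
  ren-ren-Tm h (zset A P)      = cong₂ zset (ren-ren-Ty h A) (ren-ren-SP (liftR-∘ h) P)

  ren-ren-SP : ∀ {ρ ρ' ρ''} → (∀ k → ρ (ρ' k) ≡ ρ'' k) →
               (P : SP) → renSP ρ (renSP ρ' P) ≡ renSP ρ'' P
  ren-ren-SP h (pEq K M N) = cong₃ pEq (ren-ren-Tm h K) (ren-ren-Tm h M) (ren-ren-Tm h N)
  ren-ren-SP h p⊥          = refl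
  ren-ren-SP h (P p⊃ Q)    = cong₂ _p⊃_ (ren-ren-SP h P) (ren-ren-SP h Q)
  ren-ren-SP h (p∀ M P)    = cong₂ p∀ (ren-ren-Tm h M) (ren-ren-SP (liftR-∘ h) P)
  ren-ren-SP h (p∈ A M N)  = cong₃ p∈ (ren-ren-Ty h A) (ren-ren-Tm h M) (ren-ren-Tm h N)

  ren-ren-Pr : ∀ {ρ ρ' ρ''} → (∀ k → ρ (ρ' k) ≡ ρ'' k) →
               (φ : Pr) → renPr ρ (renPr ρ' φ) ≡ renPr ρ'' φ
  ren-ren-Pr h (fEq K M N) = cong₃ fEq (ren-ren-Tm h K) (ren-ren-Tm h M) (ren-ren-Tm h N)
  ren-ren-Pr h f⊥          = refl
  ren-ren-Pr h (φ f⊃ ψ)    = cong₂ _f⊃_ (ren-ren-Pr h φ) (ren-ren-Pr h ψ)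
  ren-ren-Pr h (f∀ A φ)    = cong₂ f∀ (ren-ren-Ty h A) (ren-ren-Pr (liftR-∘ h) φ)
  ren-ren-Pr h (fV P)      = cong fV (ren-ren-SP h P)

liftS-∘R : ∀ {σ σ' : ℕ → Tm} {ρ : ℕ → ℕ} → (∀ k → σ (ρ k) ≡ σ' k) →
           ∀ k → liftS σ (liftR ρ k) ≡ liftS σ' k
liftS-∘R h zero    = refl
liftS-∘R h (suc k) = cong wkTm (h k)

mutual
  sub-ren-Ty : ∀ {σ ρ σ'} → (∀ k → σ (ρ k) ≡ σ' k) →
               (A : Ty) → subTy σ (renTy ρ A) ≡ subTy σ' A
  sub-ren-Ty h tℕ       = refl
  sub-ren-Ty h (A t× B) = cong₂ _t×_ (sub-ren-Ty h A) (sub-ren-Ty h B)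
  sub-ren-Ty h (A t⇒ B) = cong₂ _t⇒_ (sub-ren-Ty h A) (sub-ren-Ty h B)
  sub-ren-Ty h tU       = refl
  sub-ren-Ty h (tT M)   = cong tT (sub-ren-Tm h M)
  sub-ren-Ty h (tSet A) = cong tSet (sub-ren-Ty h A)

  sub-ren-Tm : ∀ {σ ρ σ'} → (∀ k → σ (ρ k) ≡ σ' k) →
               (M : Tm) → subTm σ (renTm ρ M) ≡ subTm σ' M
  sub-ren-Tm h (var n)         = h n
  sub-ren-Tm h z0              = refl
  sub-ren-Tm h (zs M)          = cong zs (sub-ren-Tm h M)
  sub-ren-Tm h (zE C L M N)    = cong₄ zE (sub-ren-Ty (liftS-∘R h) C) (sub-ren-Tm h L)
                                   (sub-ren-Tm (liftS-∘R (liftS-∘R h)) M) (sub-ren-Tm h N)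
  sub-ren-Tm h (zpair A B M N) = cong₄ zpair (sub-ren-Ty h A) (sub-ren-Ty h B) (sub-ren-Tm h M) (sub-ren-Tm h N)
  sub-ren-Tm h (zπ₁ A B M)     = cong₃ zπ₁ (sub-ren-Ty h A) (sub-ren-Ty h B) (sub-ren-Tm h M)
  sub-ren-Tm h (zπ₂ A B M)     = cong₃ zπ₂ (sub-ren-Ty h A) (sub-ren-Ty h B) (sub-ren-Tm h M)
  sub-ren-Tm h (zλ A M B)      = cong₃ zλ (sub-ren-Ty h A) (sub-ren-Tm (liftS-∘R h) M) (sub-ren-Ty h B)
  sub-ren-Tm h (zapp A B M N)  = cong₄ zapp (sub-ren-Ty h A) (sub-ren-Ty h B) (sub-ren-Tm h M) (sub-ren-Tm h N)
  sub-ren-Tm h zℕ̂              = refl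
  sub-ren-Tm h (M z×̂ N)        = cong₂ _z×̂_ (sub-ren-Tm h M) (sub-ren-Tm h N)
  sub-ren-Tm h (zset A P)      = cong₂ zset (sub-ren-Ty h A) (sub-ren-SP (liftS-∘R h) P)

  sub-ren-SP : ∀ {σ ρ σ'} → (∀ k → σ (ρ k) ≡ σ' k) →
               (P : SP) → subSP σ (renSP ρ P) ≡ subSP σ' P
  sub-ren-SP h (pEq K M N) = cong₃ pEq (sub-ren-Tm h K) (sub-ren-Tm h M) (sub-ren-Tm h N)
  sub-ren-SP h p⊥          = refl
  sub-ren-SP h (P p⊃ Q)    = cong₂ _p⊃_ (sub-ren-SP h P) (sub-ren-SP h Q)
  sub-ren-SP h (p∀ M P)    = cong₂ p∀ (sub-ren-Tm h M) (sub-ren-SP (liftS-∘R h) P)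
  sub-ren-SP h (p∈ A M N)  = cong₃ p∈ (sub-ren-Ty h A) (sub-ren-Tm h M) (sub-ren-Tm h N)

  sub-ren-Pr : ∀ {σ ρ σ'} → (∀ k → σ (ρ k) ≡ σ' k) →
               (φ : Pr) → subPr σ (renPr ρ φ) ≡ subPr σ' φ
  sub-ren-Pr h (fEq K M N) = cong₃ fEq (sub-ren-Tm h K) (sub-ren-Tm h M) (sub-ren-Tm h N)
  sub-ren-Pr h f⊥          = refl
  sub-ren-Pr h (φ f⊃ ψ)    = cong₂ _f⊃_ (sub-ren-Pr h φ) (sub-ren-Pr h ψ)
  sub-ren-Pr h (f∀ A φ)    = cong₂ f∀ (sub-ren-Ty h A) (sub-ren-Pr (liftS-∘R h) φ)
  sub-ren-Pr h (fV P)      = cong fV (sub-ren-SP h P)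

liftR-∘S : ∀ {ρ : ℕ → ℕ} {σ σ' : ℕ → Tm} → (∀ k → renTm ρ (σ k) ≡ σ' k) →
           ∀ k → renTm (liftR ρ) (liftS σ k) ≡ liftS σ' k
liftR-∘S h zero = refl
liftR-∘S {ρ} {σ} {σ'} h (suc k) = begin
  renTm (liftR ρ) (wkTm (σ k))  ≡⟨ ren-ren-Tm (λ _ → refl) (σ k) ⟩
  renTm (λ j → suc (ρ j)) (σ k) ≡⟨ sym (ren-ren-Tm (λ _ → refl) (σ k)) ⟩
  wkTm (renTm ρ (σ k))          ≡⟨ cong wkTm (h k) ⟩
  wkTm (σ' k)                   ∎
  where open ≡-Reasoning

mutual
  ren-sub-Ty : ∀ {ρ σ σ'} → (∀ k → renTm ρ (σ k) ≡ σ' k) →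
               (A : Ty) → renTy ρ (subTy σ A) ≡ subTy σ' A
  ren-sub-Ty h tℕ       = refl
  ren-sub-Ty h (A t× B) = cong₂ _t×_ (ren-sub-Ty h A) (ren-sub-Ty h B)
  ren-sub-Ty h (A t⇒ B) = cong₂ _t⇒_ (ren-sub-Ty h A) (ren-sub-Ty h B)
  ren-sub-Ty h tU       = refl
  ren-sub-Ty h (tT M)   = cong tT (ren-sub-Tm h M)
  ren-sub-Ty h (tSet A) = cong tSet (ren-sub-Ty h A)

  ren-sub-Tm : ∀ {ρ σ σ'} → (∀ k → renTm ρ (σ k) ≡ σ' k) →
               (M : Tm) → renTm ρ (subTm σ M) ≡ subTm σ' M
  ren-sub-Tm h (var n)         = h n
  ren-sub-Tm h z0              = refl
  ren-sub-Tm h (zs M)          = cong zs (ren-sub-Tm h M)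
  ren-sub-Tm h (zE C L M N)    = cong₄ zE (ren-sub-Ty (liftR-∘S h) C) (ren-sub-Tm h L)
                                   (ren-sub-Tm (liftR-∘S (liftR-∘S h)) M) (ren-sub-Tm h N)
  ren-sub-Tm h (zpair A B M N) = cong₄ zpair (ren-sub-Ty h A) (ren-sub-Ty h B) (ren-sub-Tm h M) (ren-sub-Tm h N)
  ren-sub-Tm h (zπ₁ A B M)     = cong₃ zπ₁ (ren-sub-Ty h A) (ren-sub-Ty h B) (ren-sub-Tm h M)
  ren-sub-Tm h (zπ₂ A B M)     = cong₃ zπ₂ (ren-sub-Ty h A) (ren-sub-Ty h B) (ren-sub-Tm h M)
  ren-sub-Tm h (zλ A M B)      = cong₃ zλ (ren-sub-Ty h A) (ren-sub-Tm (liftR-∘S h) M) (ren-sub-Ty h B)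
  ren-sub-Tm h (zapp A B M N)  = cong₄ zapp (ren-sub-Ty h A) (ren-sub-Ty h B) (ren-sub-Tm h M) (ren-sub-Tm h N)
  ren-sub-Tm h zℕ̂              = refl
  ren-sub-Tm h (M z×̂ N)        = cong₂ _z×̂_ (ren-sub-Tm h M) (ren-sub-Tm h N)
  ren-sub-Tm h (zset A P)      = cong₂ zset (ren-sub-Ty h A) (ren-sub-SP (liftR-∘S h) P)

  ren-sub-SP : ∀ {ρ σ σ'} → (∀ k → renTm ρ (σ k) ≡ σ' k) →
               (P : SP) → renSP ρ (subSP σ P) ≡ subSP σ' P
  ren-sub-SP h (pEq K M N) = cong₃ pEq (ren-sub-Tm h K) (ren-sub-Tm h M) (ren-sub-Tm h N)
  ren-sub-SP h p⊥          = refl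
  ren-sub-SP h (P p⊃ Q)    = cong₂ _p⊃_ (ren-sub-SP h P) (ren-sub-SP h Q)
  ren-sub-SP h (p∀ M P)    = cong₂ p∀ (ren-sub-Tm h M) (ren-sub-SP (liftR-∘S h) P)
  ren-sub-SP h (p∈ A M N)  = cong₃ p∈ (ren-sub-Ty h A) (ren-sub-Tm h M) (ren-sub-Tm h N)

  ren-sub-Pr : ∀ {ρ σ σ'} → (∀ k → renTm ρ (σ k) ≡ σ' k) →
               (φ : Pr) → renPr ρ (subPr σ φ) ≡ subPr σ' φ
  ren-sub-Pr h (fEq K M N) = cong₃ fEq (ren-sub-Tm h K) (ren-sub-Tm h M) (ren-sub-Tm h N)
  ren-sub-Pr h f⊥          = refl
  ren-sub-Pr h (φ f⊃ ψ)    = cong₂ _f⊃_ (ren-sub-Pr h φ) (ren-sub-Pr h ψ)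
  ren-sub-Pr h (f∀ A φ)    = cong₂ f∀ (ren-sub-Ty h A) (ren-sub-Pr (liftR-∘S h) φ)
  ren-sub-Pr h (fV P)      = cong fV (ren-sub-SP h P)

liftS-id : ∀ {σ : ℕ → Tm} → (∀ k → σ k ≡ var k) → ∀ k → liftS σ k ≡ var k
liftS-id h zero    = refl
liftS-id h (suc k) = cong wkTm (h k)

mutual
  sub-id-Ty : ∀ {σ} → (∀ k → σ k ≡ var k) → (A : Ty) → subTy σ A ≡ A
  sub-id-Ty h tℕ       = refl
  sub-id-Ty h (A t× B) = cong₂ _t×_ (sub-id-Ty h A) (sub-id-Ty h B)
  sub-id-Ty h (A t⇒ B) = cong₂ _t⇒_ (sub-id-Ty h A) (sub-id-Ty h B)
  sub-id-Ty h tU       = refl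
  sub-id-Ty h (tT M)   = cong tT (sub-id-Tm h M)
  sub-id-Ty h (tSet A) = cong tSet (sub-id-Ty h A)

  sub-id-Tm : ∀ {σ} → (∀ k → σ k ≡ var k) → (M : Tm) → subTm σ M ≡ M
  sub-id-Tm h (var n)         = h n
  sub-id-Tm h z0              = refl
  sub-id-Tm h (zs M)          = cong zs (sub-id-Tm h M)
  sub-id-Tm h (zE C L M N)    = cong₄ zE (sub-id-Ty (liftS-id h) C) (sub-id-Tm h L)
                                  (sub-id-Tm (liftS-id (liftS-id h)) M) (sub-id-Tm h N)
  sub-id-Tm h (zpair A B M N) = cong₄ zpair (sub-id-Ty h A) (sub-id-Ty h B) (sub-id-Tm h M) (sub-id-Tm h N)
  sub-id-Tm h (zπ₁ A B M)     = cong₃ zπ₁ (sub-id-Ty h A) (sub-id-Ty h B) (sub-id-Tm h M)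
  sub-id-Tm h (zπ₂ A B M)     = cong₃ zπ₂ (sub-id-Ty h A) (sub-id-Ty h B) (sub-id-Tm h M)
  sub-id-Tm h (zλ A M B)      = cong₃ zλ (sub-id-Ty h A) (sub-id-Tm (liftS-id h) M) (sub-id-Ty h B)
  sub-id-Tm h (zapp A B M N)  = cong₄ zapp (sub-id-Ty h A) (sub-id-Ty h B) (sub-id-Tm h M) (sub-id-Tm h N)
  sub-id-Tm h zℕ̂              = refl
  sub-id-Tm h (M z×̂ N)        = cong₂ _z×̂_ (sub-id-Tm h M) (sub-id-Tm h N)
  sub-id-Tm h (zset A P)      = cong₂ zset (sub-id-Ty h A) (sub-id-SP (liftS-id h) P)

  sub-id-SP : ∀ {σ} → (∀ k → σ k ≡ var k) → (P : SP) → subSP σ P ≡ P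
  sub-id-SP h (pEq K M N) = cong₃ pEq (sub-id-Tm h K) (sub-id-Tm h M) (sub-id-Tm h N)
  sub-id-SP h p⊥          = refl
  sub-id-SP h (P p⊃ Q)    = cong₂ _p⊃_ (sub-id-SP h P) (sub-id-SP h Q)
  sub-id-SP h (p∀ M P)    = cong₂ p∀ (sub-id-Tm h M) (sub-id-SP (liftS-id h) P)
  sub-id-SP h (p∈ A M N)  = cong₃ p∈ (sub-id-Ty h A) (sub-id-Tm h M) (sub-id-Tm h N)

  sub-id-Pr : ∀ {σ} → (∀ k → σ k ≡ var k) → (φ : Pr) → subPr σ φ ≡ φ
  sub-id-Pr h (fEq K M N) = cong₃ fEq (sub-id-Tm h K) (sub-id-Tm h M) (sub-id-Tm h N)
  sub-id-Pr h f⊥          = refl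
  sub-id-Pr h (φ f⊃ ψ)    = cong₂ _f⊃_ (sub-id-Pr h φ) (sub-id-Pr h ψ)
  sub-id-Pr h (f∀ A φ)    = cong₂ f∀ (sub-id-Ty h A) (sub-id-Pr (liftS-id h) φ)
  sub-id-Pr h (fV P)      = cong fV (sub-id-SP h P)

-- Consequences of the fusion laws for weakening under one binder, the shape
-- produced when a formula is moved under a fresh induction variable.

sub-cancels-wk₁-SP : ∀ {σ} → (∀ k → σ (liftR suc k) ≡ var k) →
                     (P : SP) → subSP σ (renSP (liftR suc) P) ≡ P
sub-cancels-wk₁-SP h P = trans (sub-ren-SP h P) (sub-id-SP (λ _ → refl) P)

sub-cancels-wk₁-Pr : ∀ {σ} → (∀ k → σ (liftR suc k) ≡ var k) →
                     (φ : Pr) → subPr σ (renPr (liftR suc) φ) ≡ φ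
sub-cancels-wk₁-Pr h φ = trans (sub-ren-Pr h φ) (sub-id-Pr (λ _ → refl) φ)

σ₁-wk₁ : ∀ N (φ : Pr) → subPr (σ₁ (wkTm N)) (renPr (liftR suc) φ) ≡ wkPr (subPr (σ₁ N) φ)
σ₁-wk₁ N φ = trans (sub-ren-Pr agree φ) (sym (ren-sub-Pr agree' φ))
  where
    σ' : ℕ → Tm
    σ' zero    = wkTm N
    σ' (suc k) = var (suc k)
    agree : ∀ k → σ₁ (wkTm N) (liftR suc k) ≡ σ' k
    agree zero    = refl
    agree (suc k) = refl
    agree' : ∀ k → wkTm (σ₁ N k) ≡ σ' k
    agree' zero    = refl
    agree' (suc k) = refl

σsuc₁-wk₁ : ∀ (φ : Pr) → renPr (liftR suc) (subPr σsuc₁ φ) ≡ subPr σsuc₁ (renPr (liftR suc) φ)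
σsuc₁-wk₁ φ = trans (ren-sub-Pr agree φ) (sym (sub-ren-Pr agree' φ))
  where
    σ' : ℕ → Tm
    σ' zero    = zs (var zero)
    σ' (suc k) = var (suc (suc k))
    agree : ∀ k → renTm (liftR suc) (σsuc₁ k) ≡ σ' k
    agree zero    = refl
    agree (suc k) = refl
    agree' : ∀ k → σsuc₁ (liftR suc k) ≡ σ' k
    agree' zero    = refl
    agree' (suc k) = refl

renTm-id : ∀ M → renTm (λ k → k) M ≡ M
renTm-id M = begin
  renTm (λ k → k) M              ≡⟨ sym (sub-id-Tm (λ _ → refl) _) ⟩
  subTm var (renTm (λ k → k) M)  ≡⟨ sub-ren-Tm (λ _ → refl) M ⟩
  subTm var M                    ≡⟨ sub-id-Tm (λ _ → refl) M ⟩
  M                              ∎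
  where open ≡-Reasoning

-- The translation commutes with renaming and substitution.  Multiplication is
-- the only translated term with a binder over a translated subterm.

ren-times : ∀ r M N → renTm r (M times N) ≡ renTm r M times renTm r N
ren-times r M N = cong (λ X → zE (tT zℕ̂) z0 (var zero plus X) (renTm r N))
  (trans (ren-ren-Tm (λ _ → refl) M) (sym (ren-ren-Tm (λ _ → refl) M)))

sub-times : ∀ σ M N → subTm σ (M times N) ≡ subTm σ M times subTm σ N
sub-times σ M N = cong (λ X → zE (tT zℕ̂) z0 (var zero plus X) (subTm σ N))
  (trans (sub-ren-Tm (λ k → ren-ren-Tm (λ _ → refl) (σ k)) M) (sym (ren-sub-Tm (λ _ → refl) M)))

-- The domain of translated number quantifiers: ℕ, as in ⟨_⟩ᶠ, or the
-- judgementally equal T(ℕ̂), which makes every translated formula analytic.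
data NumDom : Set where
  dℕ dTℕ̂ : NumDom

domTy : NumDom → Ty
domTy dℕ  = tℕ
domTy dTℕ̂ = tT zℕ̂

ren-domTy : ∀ d r → renTy r (domTy d) ≡ domTy d
ren-domTy dℕ  r = refl
ren-domTy dTℕ̂ r = refl

sub-domTy : ∀ d σ → subTy σ (domTy d) ≡ domTy d
sub-domTy dℕ  σ = refl
sub-domTy dTℕ̂ σ = refl

tr : ∀ {Δ} → NumDom → LFm Δ → Pr
tr d (s l≈ t) = fEq zℕ̂ ⟨ s ⟩ᵗ ⟨ t ⟩ᵗ
tr d (t l∈ X) = fV (p∈ tℕ ⟨ t ⟩ᵗ (var (varIdx X)))
tr d l⊥       = f⊥
tr d (φ l⊃ ψ) = tr d φ f⊃ tr d ψ
tr d (l∀n φ)  = f∀ (domTy d) (tr d φ)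
tr d (l∀s φ)  = f∀ (tSet tℕ) (tr d φ)

tr-dℕ : ∀ {Δ} (φ : LFm Δ) → tr dℕ φ ≡ ⟨ φ ⟩ᶠ
tr-dℕ (s l≈ t) = refl
tr-dℕ (t l∈ X) = refl
tr-dℕ l⊥       = refl
tr-dℕ (φ l⊃ ψ) = cong₂ _f⊃_ (tr-dℕ φ) (tr-dℕ ψ)
tr-dℕ (l∀n φ)  = cong (f∀ tℕ) (tr-dℕ φ)
tr-dℕ (l∀s φ)  = cong (f∀ (tSet tℕ)) (tr-dℕ φ)

TracksRen : ∀ {Δ Δ'} → Ren Δ Δ' → (ℕ → ℕ) → Set
TracksRen ρ r = ∀ {s} (x : Var _ s) → r (varIdx x) ≡ varIdx (ρ x)

liftTracksRen : ∀ {Δ Δ' s'} {ρ : Ren Δ Δ'} {r} → TracksRen ρ r →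
                TracksRen (liftRen {s = s'} ρ) (liftR r)
liftTracksRen h vz     = refl
liftTracksRen h (vs x) = cong suc (h x)

ren-⟨⟩ᵗ : ∀ {Δ Δ'} {ρ : Ren Δ Δ'} {r} → TracksRen ρ r →
          (t : LTm Δ) → renTm r ⟨ t ⟩ᵗ ≡ ⟨ renLTm ρ t ⟩ᵗ
ren-⟨⟩ᵗ h (lv x)   = cong var (h x)
ren-⟨⟩ᵗ h lO       = refl
ren-⟨⟩ᵗ h (lS t)   = cong zs (ren-⟨⟩ᵗ h t)
ren-⟨⟩ᵗ h (s l+ t) = cong₂ _plus_ (ren-⟨⟩ᵗ h s) (ren-⟨⟩ᵗ h t)
ren-⟨⟩ᵗ {r = r} h (s l· t) =
  trans (ren-times r ⟨ s ⟩ᵗ ⟨ t ⟩ᵗ) (cong₂ _times_ (ren-⟨⟩ᵗ h s) (ren-⟨⟩ᵗ h t))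

ren-tr : ∀ {Δ Δ'} {ρ : Ren Δ Δ'} {r} d → TracksRen ρ r →
         (φ : LFm Δ) → renPr r (tr d φ) ≡ tr d (renLFm ρ φ)
ren-tr d h (s l≈ t) = cong₂ (fEq zℕ̂) (ren-⟨⟩ᵗ h s) (ren-⟨⟩ᵗ h t)
ren-tr d h (t l∈ X) = cong₂ (λ M i → fV (p∈ tℕ M (var i))) (ren-⟨⟩ᵗ h t) (h X)
ren-tr d h l⊥       = refl
ren-tr d h (φ l⊃ ψ) = cong₂ _f⊃_ (ren-tr d h φ) (ren-tr d h ψ)
ren-tr {r = r} d h (l∀n φ) = cong₂ f∀ (ren-domTy d r) (ren-tr d (liftTracksRen h) φ)
ren-tr d h (l∀s φ)  = cong (f∀ (tSet tℕ)) (ren-tr d (liftTracksRen h) φ)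

tr-wk-hyps : ∀ {Δ s} d (Hs : List (LFm Δ)) →
             map (tr d) (map (wkLFm {s = s}) Hs) ≡ map wkPr (map (tr d) Hs)
tr-wk-hyps d []       = refl
tr-wk-hyps d (H ∷ Hs) = cong₂ _∷_ (sym (ren-tr d (λ _ → refl) H)) (tr-wk-hyps d Hs)

⟦_⟧ᵛ : ∀ {Δ} s → Val s Δ → Tm
⟦ num ⟧ᵛ t = ⟨ t ⟩ᵗ
⟦ set ⟧ᵛ X = var (varIdx X)

TracksSub : ∀ {Δ Δ'} → LSub Δ Δ' → (ℕ → Tm) → Set
TracksSub σ τ = ∀ {s} (x : Var _ s) → τ (varIdx x) ≡ ⟦ s ⟧ᵛ (σ x)

wk-⟦⟧ᵛ : ∀ {Δ s'} s (v : Val s Δ) → wkTm (⟦ s ⟧ᵛ v) ≡ ⟦ s ⟧ᵛ (wkVal {s' = s'} s v)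
wk-⟦⟧ᵛ num t = ren-⟨⟩ᵗ (λ _ → refl) t
wk-⟦⟧ᵛ set X = refl

liftTracksSub : ∀ {Δ Δ' s'} {σ : LSub Δ Δ'} {τ} → TracksSub σ τ →
                TracksSub (liftLSub {s' = s'} σ) (liftS τ)
liftTracksSub {s' = num} h vz = refl
liftTracksSub {s' = set} h vz = refl
liftTracksSub {σ = σ} h {s} (vs x) = trans (cong wkTm (h x)) (wk-⟦⟧ᵛ s (σ x))

sub-⟨⟩ᵗ : ∀ {Δ Δ'} {σ : LSub Δ Δ'} {τ} → TracksSub σ τ →
          (t : LTm Δ) → subTm τ ⟨ t ⟩ᵗ ≡ ⟨ subLTm σ t ⟩ᵗ
sub-⟨⟩ᵗ h (lv x)   = h x
sub-⟨⟩ᵗ h lO       = refl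
sub-⟨⟩ᵗ h (lS t)   = cong zs (sub-⟨⟩ᵗ h t)
sub-⟨⟩ᵗ h (s l+ t) = cong₂ _plus_ (sub-⟨⟩ᵗ h s) (sub-⟨⟩ᵗ h t)
sub-⟨⟩ᵗ {τ = τ} h (s l· t) =
  trans (sub-times τ ⟨ s ⟩ᵗ ⟨ t ⟩ᵗ) (cong₂ _times_ (sub-⟨⟩ᵗ h s) (sub-⟨⟩ᵗ h t))

sub-tr : ∀ {Δ Δ'} {σ : LSub Δ Δ'} {τ} d → TracksSub σ τ →
         (φ : LFm Δ) → subPr τ (tr d φ) ≡ tr d (subLFm σ φ)
sub-tr d h (s l≈ t) = cong₂ (fEq zℕ̂) (sub-⟨⟩ᵗ h s) (sub-⟨⟩ᵗ h t)
sub-tr d h (t l∈ X) = cong₂ (λ M N → fV (p∈ tℕ M N)) (sub-⟨⟩ᵗ h t) (h X)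
sub-tr d h l⊥       = refl
sub-tr d h (φ l⊃ ψ) = cong₂ _f⊃_ (sub-tr d h φ) (sub-tr d h ψ)
sub-tr {τ = τ} d h (l∀n φ) = cong₂ f∀ (sub-domTy d τ) (sub-tr d (liftTracksSub h) φ)
sub-tr d h (l∀s φ)  = cong (f∀ (tSet tℕ)) (sub-tr d (liftTracksSub h) φ)

inst-tracks : ∀ {Δ} (t : LTm Δ) → TracksSub (inst0 t) (σ₁ ⟨ t ⟩ᵗ)
inst-tracks t {num} vz     = refl
inst-tracks t {num} (vs x) = refl
inst-tracks t {set} (vs x) = refl

instˢ-tracks : ∀ {Δ} (X : Var Δ set) → TracksSub (inst0 X) (σ₁ (var (varIdx X)))
instˢ-tracks X {set} vz     = refl
instˢ-tracks X {num} (vs x) = refl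
instˢ-tracks X {set} (vs x) = refl

suc-tracks : ∀ {Δ} → TracksSub (sucSubL {Δ}) σsuc₁
suc-tracks {s = num} vz     = refl
suc-tracks {s = num} (vs x) = refl
suc-tracks {s = set} (vs x) = refl

ren-Arith : ∀ {Δ Δ'} (ρ : Ren Δ Δ') {φ : LFm Δ} → Arith φ → Arith (renLFm ρ φ)
ren-Arith ρ a≈       = a≈
ren-Arith ρ a∈       = a∈
ren-Arith ρ a⊥       = a⊥
ren-Arith ρ (a⊃ a b) = a⊃ (ren-Arith ρ a) (ren-Arith ρ b)
ren-Arith ρ (a∀ a)   = a∀ (ren-Arith (liftRen ρ) a)

ren-⟪⟫ : ∀ {Δ Δ'} {ρ : Ren Δ Δ'} {r} → TracksRen ρ r →
         {φ : LFm Δ} (a : Arith φ) → renSP r ⟪ a ⟫ ≡ ⟪ ren-Arith ρ a ⟫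
ren-⟪⟫ h (a≈ {s} {t}) = cong₂ (pEq zℕ̂) (ren-⟨⟩ᵗ h s) (ren-⟨⟩ᵗ h t)
ren-⟪⟫ h (a∈ {t} {X}) = cong₂ (λ M i → p∈ tℕ M (var i)) (ren-⟨⟩ᵗ h t) (h X)
ren-⟪⟫ h a⊥           = refl
ren-⟪⟫ h (a⊃ a b)     = cong₂ _p⊃_ (ren-⟪⟫ h a) (ren-⟪⟫ h b)
ren-⟪⟫ h (a∀ a)       = cong (p∀ zℕ̂) (ren-⟪⟫ (liftTracksRen h) a)

noU-tr : ∀ {Δ} d (φ : LFm Δ) → NoUQuant (tr d φ)
noU-tr d (s l≈ t) = nuEq
noU-tr d (t l∈ X) = nuV
noU-tr d l⊥       = nu⊥
noU-tr d (φ l⊃ ψ) = nu⊃ (noU-tr d φ) (noU-tr d ψ)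
noU-tr dℕ  (l∀n φ) = nu∀ refl (noU-tr dℕ φ)
noU-tr dTℕ̂ (l∀n φ) = nu∀ refl (noU-tr dTℕ̂ φ)
noU-tr d (l∀s φ)  = nu∀ refl (noU-tr d φ)

analytic-tr : ∀ {Δ} (φ : LFm Δ) → Analytic (tr dTℕ̂ φ)
analytic-tr (s l≈ t) = anEq
analytic-tr (t l∈ X) = anV
analytic-tr l⊥       = an⊥
analytic-tr (φ l⊃ ψ) = an⊃ (analytic-tr φ) (analytic-tr ψ)
analytic-tr (l∀n φ)  = an∀T (analytic-tr φ)
analytic-tr (l∀s φ)  = an∀S (analytic-tr φ)

-- The contexts Γmn m n are of this kind,
-- and the extra freedom is what lets us go under small quantifiers ∀̂x:ℕ̂.
data Realises : SCtx → Ctx → Set where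
  []ʳ   : Realises [] []
  numʳ  : ∀ {Δ Γ} (d : NumDom) → Realises Δ Γ → Realises (num ∷ Δ) (domTy d ∷ Γ)
  setʳ  : ∀ {Δ Γ} → Realises Δ Γ → Realises (set ∷ Δ) (tSet tℕ ∷ Γ)

realises-sortTy : ∀ Δ → Realises Δ (map sortTy Δ)
realises-sortTy []        = []ʳ
realises-sortTy (num ∷ Δ) = numʳ dℕ (realises-sortTy Δ)
realises-sortTy (set ∷ Δ) = setʳ (realises-sortTy Δ)

NumVar : Ctx → ℕ → Set
NumVar Γ i = Σ NumDom (λ d → Lookup Γ i (domTy d))

numVar-there : ∀ {Γ B i} → NumVar Γ i → NumVar (B ∷ Γ) (suc i)
numVar-there (dℕ  , l) = dℕ  , there l
numVar-there (dTℕ̂ , l) = dTℕ̂ , there l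

numVar-here : ∀ {Γ} d → NumVar (domTy d ∷ Γ) zero
numVar-here dℕ  = dℕ  , here
numVar-here dTℕ̂ = dTℕ̂ , here

lookup-num : ∀ {Δ Γ} → Realises Δ Γ → (x : Var Δ num) → NumVar Γ (varIdx x)
lookup-num (numʳ d g) vz     = numVar-here d
lookup-num (numʳ d g) (vs x) = numVar-there (lookup-num g x)
lookup-num (setʳ g)   (vs x) = numVar-there (lookup-num g x)

lookup-set : ∀ {Δ Γ} → Realises Δ Γ → (x : Var Δ set) → Lookup Γ (varIdx x) (tSet tℕ)
lookup-set (numʳ d g) (vs x) = there (lookup-set g x)
lookup-set (setʳ g)   vz     = here
lookup-set (setʳ g)   (vs x) = there (lookup-set g x)

recOk : ∀ S → ENOk S (tT zℕ̂)
recOk LTTW  = tt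
recOk LTT0  = isT
recOk LTT0* = isT

module Typing (S : Sys) where

  toTℕ̂ : ∀ {Γ M} → S ▷ Γ ⊢ valid → S ▷ Γ ⊢ hasTy M tℕ → S ▷ Γ ⊢ hasTy M (tT zℕ̂)
  toTℕ̂ v p = convTm p (tySym (Tℕ̂ v))

  fromTℕ̂ : ∀ {Γ M} → S ▷ Γ ⊢ valid → S ▷ Γ ⊢ hasTy M (tT zℕ̂) → S ▷ Γ ⊢ hasTy M tℕ
  fromTℕ̂ v p = convTm p (Tℕ̂ v)

  ⊢domTy : ∀ {Γ} d → S ▷ Γ ⊢ valid → S ▷ Γ ⊢ isType (domTy d)
  ⊢domTy dℕ  v = ℕF v
  ⊢domTy dTℕ̂ v = TF (ℕ̂I v)

  domTy-eq : ∀ {Γ} → S ▷ Γ ⊢ valid → ∀ d d' → S ▷ Γ ⊢ tyEq (domTy d) (domTy d')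
  domTy-eq v dℕ  dℕ  = tyRefl (ℕF v)
  domTy-eq v dℕ  dTℕ̂ = tySym (Tℕ̂ v)
  domTy-eq v dTℕ̂ dℕ  = Tℕ̂ v
  domTy-eq v dTℕ̂ dTℕ̂ = tyRefl (TF (ℕ̂I v))

  valid-num : ∀ {Γ} d → S ▷ Γ ⊢ valid → S ▷ (domTy d ∷ Γ) ⊢ valid
  valid-num d v = ctxExt (⊢domTy d v)

  ⊢valid : ∀ {Δ Γ} → Realises Δ Γ → S ▷ Γ ⊢ valid
  ⊢valid []ʳ        = ctxEmpty
  ⊢valid (numʳ d g) = valid-num d (⊢valid g)
  ⊢valid (setʳ g)   = ctxExt (SetF (ℕF (⊢valid g)))

  ⊢numVar : ∀ {Γ i} → S ▷ Γ ⊢ valid → NumVar Γ i → S ▷ Γ ⊢ hasTy (var i) tℕ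
  ⊢numVar v (dℕ  , l) = varR v l
  ⊢numVar v (dTℕ̂ , l) = fromTℕ̂ v (varR v l)

  module _ {Γ L M} (v : S ▷ Γ ⊢ valid) (⊢L : S ▷ Γ ⊢ hasTy L tℕ)
           (⊢M : S ▷ (tT zℕ̂ ∷ tℕ ∷ Γ) ⊢ hasTy M tℕ) where
    private
      v₁ = valid-num dℕ v
      v₂ = valid-num dTℕ̂ v₁
      ⊢C = TF (ℕ̂I v₁)

    ⊢rec : ∀ {N} → S ▷ Γ ⊢ hasTy N tℕ → S ▷ Γ ⊢ hasTy (zE (tT zℕ̂) L M N) tℕ
    ⊢rec ⊢N = fromTℕ̂ v (EI (recOk S) ⊢C (toTℕ̂ v ⊢L) (toTℕ̂ v₂ ⊢M) ⊢N)

    rec-zero : S ▷ Γ ⊢ tmEq (zE (tT zℕ̂) L M z0) L (tT zℕ̂)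
    rec-zero = E0 (recOk S) ⊢C (toTℕ̂ v ⊢L) (toTℕ̂ v₂ ⊢M)

    rec-suc : ∀ {N} → S ▷ Γ ⊢ hasTy N tℕ →
              S ▷ Γ ⊢ tmEq (zE (tT zℕ̂) L M (zs N)) (subTm (σ₂ N (zE (tT zℕ̂) L M N)) M) (tT zℕ̂)
    rec-suc ⊢N = Es (recOk S) ⊢C (toTℕ̂ v ⊢L) (toTℕ̂ v₂ ⊢M) ⊢N

  -- Translated terms have type ℕ.  The renaming r is needed because the
  -- translation of a product mentions a doubly weakened factor.
  ⊢⟨⟩ᵗ-ren : ∀ {Δ Γ} → S ▷ Γ ⊢ valid → (r : ℕ → ℕ) →
             ((x : Var Δ num) → NumVar Γ (r (varIdx x))) →
             (t : LTm Δ) → S ▷ Γ ⊢ hasTy (renTm r ⟨ t ⟩ᵗ) tℕ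
  ⊢⟨⟩ᵗ-ren v r h (lv x)   = ⊢numVar v (h x)
  ⊢⟨⟩ᵗ-ren v r h lO       = 0I v
  ⊢⟨⟩ᵗ-ren v r h (lS t)   = sI (⊢⟨⟩ᵗ-ren v r h t)
  ⊢⟨⟩ᵗ-ren v r h (s l+ t) =
    ⊢rec v (⊢⟨⟩ᵗ-ren v r h s) (sI (⊢numVar v₂ (dTℕ̂ , here))) (⊢⟨⟩ᵗ-ren v r h t)
    where v₂ = valid-num dTℕ̂ (valid-num dℕ v)
  ⊢⟨⟩ᵗ-ren v r h (s l· t) =
    ⊢rec v (0I v)
      (⊢rec v₂ (⊢numVar v₂ (dTℕ̂ , here)) (sI (⊢numVar v₄ (dTℕ̂ , here)))
        (subst (λ X → S ▷ _ ⊢ hasTy X tℕ) (sym (ren-ren-Tm (λ _ → refl) ⟨ s ⟩ᵗ))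
          (⊢⟨⟩ᵗ-ren v₂ (λ k → suc (suc (r k))) (λ x → numVar-there (numVar-there (h x))) s)))
      (⊢⟨⟩ᵗ-ren v r h t)
    where v₂ = valid-num dTℕ̂ (valid-num dℕ v)
          v₄ = valid-num dTℕ̂ (valid-num dℕ v₂)

  ⊢⟨⟩ᵗ : ∀ {Δ Γ} → Realises Δ Γ → (t : LTm Δ) → S ▷ Γ ⊢ hasTy ⟨ t ⟩ᵗ tℕ
  ⊢⟨⟩ᵗ g t = subst (λ X → S ▷ _ ⊢ hasTy X tℕ) (renTm-id ⟨ t ⟩ᵗ)
               (⊢⟨⟩ᵗ-ren (⊢valid g) (λ k → k) (lookup-num g) t)

  ⊢⟨⟩ᵗ̂ : ∀ {Δ Γ} → Realises Δ Γ → (t : LTm Δ) → S ▷ Γ ⊢ hasTy ⟨ t ⟩ᵗ (tT zℕ̂)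
  ⊢⟨⟩ᵗ̂ g t = toTℕ̂ (⊢valid g) (⊢⟨⟩ᵗ g t)

  ⊢setVar : ∀ {Δ Γ} → Realises Δ Γ → (X : Var Δ set) → S ▷ Γ ⊢ hasTy (var (varIdx X)) (tSet tℕ)
  ⊢setVar g X = varR (⊢valid g) (lookup-set g X)

  ⊢tr : ∀ {Δ Γ} → Realises Δ Γ → ∀ d (φ : LFm Δ) → S ▷ Γ ⊢ isPr (tr d φ)
  ⊢tr g d (s l≈ t) = =F (ℕ̂I (⊢valid g)) (⊢⟨⟩ᵗ̂ g s) (⊢⟨⟩ᵗ̂ g t)
  ⊢tr g d (t l∈ X) = VF (∈̂F (⊢⟨⟩ᵗ g t) (⊢setVar g X))
  ⊢tr g d l⊥       = ⊥F (⊢valid g)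
  ⊢tr g d (φ l⊃ ψ) = ⊃F (⊢tr g d φ) (⊢tr g d ψ)
  ⊢tr g d (l∀n φ)  = ∀F (⊢tr (numʳ d g) d φ)
  ⊢tr g d (l∀s φ)  = ∀F (⊢tr (setʳ g) d φ)

  ⊢tr-hyps : ∀ {Δ Γ} → Realises Δ Γ → ∀ d (Hs : List (LFm Δ)) →
             All (λ ψ → S ▷ Γ ⊢ isPr ψ) (map (tr d) Hs)
  ⊢tr-hyps g d []       = []
  ⊢tr-hyps g d (H ∷ Hs) = ⊢tr g d H ∷ ⊢tr-hyps g d Hs

  tr-dom-eq : ∀ {Δ Γ} → Realises Δ Γ → ∀ d d' (φ : LFm Δ) → S ▷ Γ ⊢ prEq (tr d φ) (tr d' φ)
  tr-dom-eq g d d' (φ l⊃ ψ) = ⊃Cong (tr-dom-eq g d d' φ) (tr-dom-eq g d d' ψ)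
  tr-dom-eq g d d' (l∀n φ)  = ∀Cong (domTy-eq (⊢valid g) d d') (tr-dom-eq (numʳ d g) d d' φ)
  tr-dom-eq g d d' (l∀s φ)  = ∀Cong (tyRefl (SetF (ℕF (⊢valid g)))) (tr-dom-eq (setʳ g) d d' φ)
  tr-dom-eq g d d' φ@(_ l≈ _) = prRefl (⊢tr g d φ)
  tr-dom-eq g d d' φ@(_ l∈ _) = prRefl (⊢tr g d φ)
  tr-dom-eq g d d' l⊥       = prRefl (⊥F (⊢valid g))

  ⊢⟪⟫ : ∀ {Δ Γ} → Realises Δ Γ → {φ : LFm Δ} (a : Arith φ) → S ▷ Γ ⊢ isSP ⟪ a ⟫
  ⊢⟪⟫ g (a≈ {s} {t}) = =̂F (ℕ̂I (⊢valid g)) (⊢⟨⟩ᵗ̂ g s) (⊢⟨⟩ᵗ̂ g t)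
  ⊢⟪⟫ g (a∈ {t} {X}) = ∈̂F (⊢⟨⟩ᵗ g t) (⊢setVar g X)
  ⊢⟪⟫ g a⊥           = ⊥̂F (⊢valid g)
  ⊢⟪⟫ g (a⊃ a b)     = ⊃̂F (⊢⟪⟫ g a) (⊢⟪⟫ g b)
  ⊢⟪⟫ g (a∀ a)       = ∀̂F (ℕ̂I (⊢valid g)) (⊢⟪⟫ (numʳ dTℕ̂ g) a)

  V⟪⟫≡tr : ∀ {Δ Γ} → Realises Δ Γ → ∀ d {φ : LFm Δ} (a : Arith φ) →
           S ▷ Γ ⊢ prEq (fV ⟪ a ⟫) (tr d φ)
  V⟪⟫≡tr g d (a≈ {s} {t}) = V= (ℕ̂I (⊢valid g)) (⊢⟨⟩ᵗ̂ g s) (⊢⟨⟩ᵗ̂ g t)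
  V⟪⟫≡tr g d (a∈ {t} {X}) = prRefl (VF (∈̂F (⊢⟨⟩ᵗ g t) (⊢setVar g X)))
  V⟪⟫≡tr g d a⊥           = V⊥ (⊢valid g)
  V⟪⟫≡tr g d (a⊃ a b)     =
    prTrans (V⊃ (⊢⟪⟫ g a) (⊢⟪⟫ g b)) (⊃Cong (V⟪⟫≡tr g d a) (V⟪⟫≡tr g d b))
  V⟪⟫≡tr g d (a∀ a)       =
    prTrans (V∀ (ℕ̂I (⊢valid g)) (⊢⟪⟫ (numʳ dTℕ̂ g) a))
            (∀Cong (domTy-eq (⊢valid g) dTℕ̂ d) (V⟪⟫≡tr (numʳ dTℕ̂ g) d a))

_f↔_ : Pr → Pr → Pr
A f↔ B = f¬ ((A f⊃ B) f⊃ f¬ (B f⊃ A))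

predTm : Tm → Tm
predTm N = zE (tT zℕ̂) z0 (var (suc zero)) N

module Soundness (S : Sys) (zeroOk : ZeroOk S) (indV : ∀ P → IndOk S (fV P))
                 (substOk : ∀ φ → NoUQuant φ → SubstOk S φ) where
  open Typing S

  T : ∀ {Δ} → LFm Δ → Pr
  T = tr dℕ

  Ent : Ctx → ∀ {Δ} → List (LFm Δ) → Pr → Set
  Ent Γ Hs ψ = S ▷ Γ ⊢ entails (map T Hs) ψ

  ∀I-hyps : ∀ {Δ Γ s A ψ} (Hs : List (LFm Δ)) →
            Ent (A ∷ Γ) (map (wkLFm {s = s}) Hs) ψ → Ent Γ Hs (f∀ A ψ)
  ∀I-hyps {ψ = ψ} Hs p = ∀I (subst (λ Φ → S ▷ _ ⊢ entails Φ ψ) (tr-wk-hyps dℕ Hs) p)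

  iff-from-eq : ∀ {Γ Φ A B} → S ▷ Γ ⊢ valid → All (λ ψ → S ▷ Γ ⊢ isPr ψ) Φ →
                S ▷ Γ ⊢ isPr A → S ▷ Γ ⊢ isPr B → S ▷ Γ ⊢ prEq A B →
                S ▷ Γ ⊢ entails Φ (A f↔ B)
  iff-from-eq v ⊢Φ ⊢A ⊢B A≡B =
    ⊃I (⊃E (⊃E (assum ⊢Φ' (here refl)) (⊃I (convEnt (assum (⊢A ∷ ⊢Φ') (here refl)) A≡B)))
           (⊃I (convEnt (assum (⊢B ∷ ⊢Φ') (here refl)) (prSym A≡B))))
    where ⊢Φ' = ⊃F (⊃F ⊢A ⊢B) (⊃F (⊃F ⊢B ⊢A) (⊥F v)) ∷ ⊢Φ

  eq-from-eq : ∀ {Γ Φ M N} → S ▷ Γ ⊢ valid → All (λ ψ → S ▷ Γ ⊢ isPr ψ) Φ →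
               S ▷ Γ ⊢ hasTy M (tT zℕ̂) → S ▷ Γ ⊢ tmEq M N (tT zℕ̂) →
               S ▷ Γ ⊢ entails Φ (fEq zℕ̂ M N)
  eq-from-eq v ⊢Φ ⊢M M≡N = convEnt (=refl ⊢Φ ⊢M) (=Cong (tmRefl (ℕ̂I v)) (tmRefl ⊢M) M≡N)

  -- ∀x. ¬(S x = 0): the extra rule of LTT₀ after turning  S x = 0  around
  sound-suc≠0 : ∀ {Δ Γ} → Realises Δ Γ → (Hs : List (LFm Δ)) →
                Ent Γ Hs (T {Δ} (l∀n (l¬ (lS (lv vz) l≈ lO))))
  sound-suc≠0 g Hs = ∀I-hyps Hs (⊃I (⊃E (zeroNotSuc zeroOk ⊢Φ (⊢⟨⟩ᵗ g₁ (lv vz))) zero≡sx))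
    where
      g₁ = numʳ dℕ g
      ⊢Φ = ⊢tr-hyps g₁ dℕ ((lS (lv vz) l≈ lO) ∷ map wkLFm Hs)
      -- rewrite  z = S x  along the hypothesis  S x = 0
      zero≡sx = =subst {N = zℕ̂} {M₁ = zs (var 0)} {M₂ = z0} {φ = fEq zℕ̂ (var 0) (zs (var 1))}
                  (substOk _ nuEq) (⊢tr (numʳ dTℕ̂ g₁) dℕ (lv vz l≈ lS (lv (vs vz))))
                  (assum ⊢Φ (here refl)) (=refl ⊢Φ (⊢⟨⟩ᵗ̂ g₁ (lS (lv vz))))

  -- ∀x∀y. S x = S y ⊃ x = y: rewrite  pred (S x) = pred z  and compute
  sound-suc-inj : ∀ {Δ Γ} → Realises Δ Γ → (Hs : List (LFm Δ)) →
    Ent Γ Hs (T {Δ} (l∀n (l∀n ((lS (lv (vs vz)) l≈ lS (lv vz)) l⊃ (lv (vs vz) l≈ lv vz)))))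
  sound-suc-inj g Hs = ∀I-hyps Hs (∀I-hyps (map wkLFm Hs) (⊃I (convEnt pred-eq
      (=Cong (tmRefl (ℕ̂I v₂)) (pred-suc (lv (vs vz))) (pred-suc (lv vz))))))
    where
      g₂ = numʳ dℕ (numʳ dℕ g)
      v₂ = ⊢valid g₂
      g₃ = numʳ dTℕ̂ g₂
      v₃ = ⊢valid g₃
      ⊢Φ = ⊢tr-hyps g₂ dℕ ((lS (lv (vs vz)) l≈ lS (lv vz)) ∷ map wkLFm (map wkLFm Hs))
      ⊢pred₂ = ⊢⟨⟩ᵗ (numʳ dTℕ̂ (numʳ dℕ g₂)) (lv (vs vz))
      ⊢pred₃ = ⊢⟨⟩ᵗ (numʳ dTℕ̂ (numʳ dℕ g₃)) (lv (vs vz))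
      pred-suc : ∀ t → S ▷ _ ⊢ tmEq (predTm (zs ⟨ t ⟩ᵗ)) ⟨ t ⟩ᵗ (tT zℕ̂)
      pred-suc t = rec-suc v₂ (0I v₂) ⊢pred₂ (⊢⟨⟩ᵗ g₂ t)
      ⊢motive = =F (ℕ̂I v₃) (toTℕ̂ v₃ (⊢rec v₃ (0I v₃) ⊢pred₃ (⊢⟨⟩ᵗ g₃ (lS (lv (vs (vs vz)))))))
                           (toTℕ̂ v₃ (⊢rec v₃ (0I v₃) ⊢pred₃ (⊢⟨⟩ᵗ g₃ (lv vz))))
      pred-eq = =subst {N = zℕ̂} {M₁ = zs (var 1)} {M₂ = zs (var 0)}
                  {φ = fEq zℕ̂ (predTm (zs (var 2))) (predTm (var 0))}
                  (substOk _ nuEq) ⊢motive (assum ⊢Φ (here refl))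
                  (=refl ⊢Φ (toTℕ̂ v₂ (⊢rec v₂ (0I v₂) ⊢pred₂ (⊢⟨⟩ᵗ g₂ (lS (lv (vs vz)))))))

  sound-add0 : ∀ {Δ Γ} → Realises Δ Γ → (Hs : List (LFm Δ)) →
               Ent Γ Hs (T {Δ} (l∀n ((lv vz l+ lO) l≈ lv vz)))
  sound-add0 g Hs = ∀I-hyps Hs (eq-from-eq v₁ (⊢tr-hyps g₁ dℕ (map wkLFm Hs))
      (⊢⟨⟩ᵗ̂ g₁ (lv vz l+ lO)) (rec-zero v₁ (⊢⟨⟩ᵗ g₁ (lv vz)) (⊢⟨⟩ᵗ (numʳ dTℕ̂ (numʳ dℕ g₁)) (lS (lv vz)))))
    where g₁ = numʳ dℕ g
          v₁ = ⊢valid g₁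

  sound-addS : ∀ {Δ Γ} → Realises Δ Γ → (Hs : List (LFm Δ)) →
    Ent Γ Hs (T {Δ} (l∀n (l∀n ((lv (vs vz) l+ lS (lv vz)) l≈ lS (lv (vs vz) l+ lv vz)))))
  sound-addS g Hs = ∀I-hyps Hs (∀I-hyps (map wkLFm Hs) (eq-from-eq v₂
      (⊢tr-hyps g₂ dℕ (map wkLFm (map wkLFm Hs))) (⊢⟨⟩ᵗ̂ g₂ (lv (vs vz) l+ lS (lv vz)))
      (rec-suc v₂ (⊢⟨⟩ᵗ g₂ (lv (vs vz))) (⊢⟨⟩ᵗ (numʳ dTℕ̂ (numʳ dℕ g₂)) (lS (lv vz))) (⊢⟨⟩ᵗ g₂ (lv vz)))))
    where g₂ = numʳ dℕ (numʳ dℕ g)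
          v₂ = ⊢valid g₂

  sound-mul0 : ∀ {Δ Γ} → Realises Δ Γ → (Hs : List (LFm Δ)) →
               Ent Γ Hs (T {Δ} (l∀n ((lv vz l· lO) l≈ lO)))
  sound-mul0 g Hs = ∀I-hyps Hs (eq-from-eq v₁ (⊢tr-hyps g₁ dℕ (map wkLFm Hs))
      (⊢⟨⟩ᵗ̂ g₁ (lv vz l· lO))
      (rec-zero v₁ (0I v₁) (⊢⟨⟩ᵗ (numʳ dTℕ̂ (numʳ dℕ g₁)) (lv vz l+ lv (vs (vs vz))))))
    where g₁ = numʳ dℕ g
          v₁ = ⊢valid g₁

  sound-mulS : ∀ {Δ Γ} → Realises Δ Γ → (Hs : List (LFm Δ)) →
    Ent Γ Hs (T {Δ} (l∀n (l∀n ((lv (vs vz) l· lS (lv vz)) l≈ ((lv (vs vz) l· lv vz) l+ lv (vs vz))))))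
  sound-mulS g Hs = ∀I-hyps Hs (∀I-hyps (map wkLFm Hs) (eq-from-eq v₂
      (⊢tr-hyps g₂ dℕ (map wkLFm (map wkLFm Hs))) (⊢⟨⟩ᵗ̂ g₂ (lv (vs vz) l· lS (lv vz)))
      (rec-suc v₂ (0I v₂) (⊢⟨⟩ᵗ (numʳ dTℕ̂ (numʳ dℕ g₂)) (lv vz l+ lv (vs (vs (vs vz)))))
               (⊢⟨⟩ᵗ g₂ (lv vz)))))
    where g₂ = numʳ dℕ (numʳ dℕ g)
          v₂ = ⊢valid g₂

  -- set induction is (Ind_ℕ) for the small proposition  x ∈ X
  sound-set-ind : ∀ {Δ Γ} → Realises Δ Γ → (Hs : List (LFm Δ)) → Ent Γ Hs (T {Δ} setInduction)
  sound-set-ind {Δ} {Γ} g Hs = ∀I-hyps Hs (⊃I (⊃I (∀I-hyps Hs₁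
      (indℕ {N = var 0} {φ = x∈X} (indV _) (⊢tr g₄ dℕ (lv vz l∈ vs (vs vz))) (⊢⟨⟩ᵗ g₃ (lv vz))
            base step))))
    where
      g₃ = numʳ dℕ (setʳ g)
      g₄ = numʳ dℕ g₃
      x∈X = fV (p∈ tℕ (var 0) (var 2))
      zero∈X : LFm (set ∷ Δ)
      zero∈X = lO l∈ vz
      closed : LFm (set ∷ Δ)
      closed = l∀n ((lv vz l∈ vs vz) l⊃ (lS (lv vz) l∈ vs vz))
      Hs₁ = closed ∷ zero∈X ∷ map wkLFm Hs
      base = assum (⊢tr-hyps g₃ dℕ (map wkLFm Hs₁)) (there (here refl))
      ⊢Φ₄ = ⊢tr-hyps g₄ dℕ ((lv vz l∈ vs (vs vz)) ∷ map wkLFm (map wkLFm Hs₁))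
      step = subst (λ Φ → S ▷ (tℕ ∷ tℕ ∷ tSet tℕ ∷ Γ) ⊢ entails (x∈X ∷ Φ) (fV (p∈ tℕ (zs (var 0)) (var 2))))
               (tr-wk-hyps dℕ (map wkLFm Hs₁))
               (⊃E (∀E (assum ⊢Φ₄ (there (here refl))) (⊢⟨⟩ᵗ g₄ (lv vz))) (assum ⊢Φ₄ (here refl)))

  -- Comprehension: the witness is the set  {x : ℕ | ⟪φ⟫},  and  x ∈ {x | ⟪φ⟫}
  -- is judgementally equal to ⟨φ⟩.
  sound-comprehension : ∀ {Δ Γ} → Realises Δ Γ → (Hs : List (LFm Δ)) →
                        (φ : LFm (num ∷ Δ)) → Arith φ → Ent Γ Hs (T (comprehension φ))
  sound-comprehension {Δ} {Γ} g Hs φ a =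
    ⊃I (⊃E (∀E (assum ⊢Φ (here refl)) ⊢W)
           (subst (λ Z → Ent Γ (noWitness ∷ Hs) (f∀ tℕ (x∈W f↔ Z))) (sym body≡) equiv))
    where
      g₁ = numʳ dℕ g
      φ' : LFm (num ∷ set ∷ Δ)
      φ' = renLFm (liftRen vs) φ
      noWitness : LFm Δ
      noWitness = l∀s (l¬ (l∀n ((lv vz l∈ vs vz) l↔ φ')))
      ⊢Φ = ⊢tr-hyps g dℕ (noWitness ∷ Hs)
      W = zset tℕ ⟪ a ⟫
      ⊢W = setI (⊢⟪⟫ g₁ a)
      -- under the binder x, W reads  {y : ℕ | P'}
      P' = renSP (liftR suc) ⟪ a ⟫
      ⊢P' : S ▷ (tℕ ∷ tℕ ∷ Γ) ⊢ isSP P'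
      ⊢P' = subst (λ P → S ▷ _ ⊢ isSP P) (sym (ren-⟪⟫ (liftTracksRen (λ _ → refl)) a))
              (⊢⟪⟫ (numʳ dℕ g₁) (ren-Arith (liftRen vs) a))
      x∈W = fV (p∈ tℕ (var 0) (zset tℕ P'))
      x∈W≡φ : S ▷ (tℕ ∷ Γ) ⊢ prEq x∈W (T φ)
      x∈W≡φ = prTrans (VCong (∈̂β (⊢⟨⟩ᵗ g₁ (lv vz)) ⊢P'))
                (subst (λ P → S ▷ _ ⊢ prEq (fV P) (T φ))
                  (sym (sub-cancels-wk₁-SP (λ { zero → refl ; (suc k) → refl }) ⟪ a ⟫))
                  (V⟪⟫≡tr g₁ dℕ a))
      equiv = ∀I-hyps (noWitness ∷ Hs)
                (iff-from-eq (⊢valid g₁) (⊢tr-hyps g₁ dℕ (map wkLFm (noWitness ∷ Hs)))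
                  (VF (∈̂F (⊢⟨⟩ᵗ g₁ (lv vz)) (setI ⊢P'))) (⊢tr g₁ dℕ φ) x∈W≡φ)
      body≡ : subPr (liftS (σ₁ W)) (T φ') ≡ T φ
      body≡ = trans (cong (subPr (liftS (σ₁ W))) (sym (ren-tr dℕ (liftTracksRen (λ _ → refl)) φ)))
                    (sub-cancels-wk₁-Pr (λ { zero → refl ; (suc k) → refl }) (T φ))

  -- After introducing the two premises and
  -- the variable x, we induct on the analytic formula  ψ = ⟨φ⁺⟩  (number
  -- quantifiers read over T(ℕ̂)), where φ⁺ is φ moved under a fresh induction
  -- variable; conversions between the two readings are judgemental.
  module InductionScheme (analyticInd : ∀ ψ → Analytic ψ → IndOk S ψ)
                         {Δ Γ} (g : Realises Δ Γ) (Hs : List (LFm Δ)) (φ : LFm (num ∷ Δ)) where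
    open ≡-Reasoning

    φ[Sx] : LFm (num ∷ Δ)
    φ[Sx] = subLFm sucSubL φ

    baseCase stepCase : LFm Δ
    baseCase = φ [ lO ]ⁿ
    stepCase = l∀n (φ l⊃ φ[Sx])

    Hs₁ : List (LFm (num ∷ Δ))
    Hs₁ = map wkLFm (stepCase ∷ baseCase ∷ Hs)

    g₁ = numʳ dℕ g
    g₂ = numʳ dℕ g₁

    φ⁺ : LFm (num ∷ num ∷ Δ)
    φ⁺ = renLFm (liftRen vs) φ

    ψ : Pr
    ψ = tr dTℕ̂ φ⁺

    tr-φ⁺ : ∀ d → tr d φ⁺ ≡ renPr (liftR suc) (tr d φ)
    tr-φ⁺ d = sym (ren-tr d (liftTracksRen (λ _ → refl)) φ)

    ψ[0]≡ : subPr (σ₁ z0) ψ ≡ tr dTℕ̂ (wkLFm {s = num} baseCase)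
    ψ[0]≡ = begin
      subPr (σ₁ z0) ψ                                  ≡⟨ cong (subPr (σ₁ z0)) (tr-φ⁺ dTℕ̂) ⟩
      subPr (σ₁ z0) (renPr (liftR suc) (tr dTℕ̂ φ))     ≡⟨ σ₁-wk₁ z0 (tr dTℕ̂ φ) ⟩
      wkPr (subPr (σ₁ z0) (tr dTℕ̂ φ))                  ≡⟨ cong wkPr (sub-tr dTℕ̂ (inst-tracks lO) φ) ⟩
      wkPr (tr dTℕ̂ baseCase)                          ≡⟨ ren-tr dTℕ̂ (λ _ → refl) baseCase ⟩
      tr dTℕ̂ (wkLFm {s = num} baseCase)                         ∎

    ψ[x]≡ : subPr (σ₁ (var 0)) ψ ≡ tr dTℕ̂ φ
    ψ[x]≡ = trans (cong (subPr (σ₁ (var 0))) (tr-φ⁺ dTℕ̂))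
                  (sub-cancels-wk₁-Pr (λ { zero → refl ; (suc k) → refl }) (tr dTℕ̂ φ))

    premise≡ : subPr (σ₁ (var 0)) (T (renLFm (liftRen vs) (renLFm (liftRen vs) (φ l⊃ φ[Sx]))))
               ≡ renPr (liftR suc) (T (φ l⊃ φ[Sx]))
    premise≡ = begin
      subPr (σ₁ (var 0)) (T (renLFm (liftRen vs) (renLFm (liftRen vs) χ)))
        ≡⟨ cong (subPr (σ₁ (var 0))) (sym (ren-tr dℕ wk₁ (renLFm (liftRen vs) χ))) ⟩
      subPr (σ₁ (var 0)) (renPr (liftR suc) (T (renLFm (liftRen vs) χ)))
        ≡⟨ sub-cancels-wk₁-Pr (λ { zero → refl ; (suc k) → refl }) _ ⟩
      T (renLFm (liftRen vs) χ)
        ≡⟨ sym (ren-tr dℕ wk₁ χ) ⟩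
      renPr (liftR suc) (T χ) ∎
      where χ = φ l⊃ φ[Sx]
            wk₁ : ∀ {Δ'} → TracksRen {num ∷ Δ'} {num ∷ num ∷ Δ'} (liftRen vs) (liftR suc)
            wk₁ = liftTracksRen (λ _ → refl)

    φ[Sx]⁺≡ : renPr (liftR suc) (T φ[Sx]) ≡ subPr σsuc₁ (T φ⁺)
    φ[Sx]⁺≡ = begin
      renPr (liftR suc) (T φ[Sx])               ≡⟨ cong (renPr (liftR suc)) (sym (sub-tr dℕ suc-tracks φ)) ⟩
      renPr (liftR suc) (subPr σsuc₁ (T φ))     ≡⟨ σsuc₁-wk₁ (T φ) ⟩
      subPr σsuc₁ (renPr (liftR suc) (T φ))     ≡⟨ cong (subPr σsuc₁) (sym (tr-φ⁺ dℕ)) ⟩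
      subPr σsuc₁ (T φ⁺)                        ∎

    base : Ent (tℕ ∷ Γ) Hs₁ (subPr (σ₁ z0) ψ)
    base = convEnt (assum (⊢tr-hyps g₁ dℕ Hs₁) (there (here refl)))
             (subst (λ Z → S ▷ _ ⊢ prEq (T (wkLFm {s = num} baseCase)) Z) (sym ψ[0]≡)
               (tr-dom-eq g₁ dℕ dTℕ̂ (wkLFm {s = num} baseCase)))

    step : S ▷ (tℕ ∷ tℕ ∷ Γ) ⊢ entails (ψ ∷ map wkPr (map T Hs₁)) (subPr σsuc₁ ψ)
    step = subst (λ Φ → S ▷ (tℕ ∷ tℕ ∷ Γ) ⊢ entails (ψ ∷ Φ) (subPr σsuc₁ ψ)) (tr-wk-hyps dℕ Hs₁)
             (convEnt (⊃E premise (convEnt (assum ⊢Φ (here refl)) ψ≡φ⁺)) φ[Sx]⁺≡ψ[Sx])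
      where
        Γ₂ = tℕ ∷ tℕ ∷ Γ
        Φ₂ = ψ ∷ map T (map (wkLFm {s = num}) Hs₁)
        ⊢Φ = ⊢tr g₂ dTℕ̂ φ⁺ ∷ ⊢tr-hyps g₂ dℕ (map (wkLFm {s = num}) Hs₁)
        premise : S ▷ Γ₂ ⊢ entails Φ₂ (renPr (liftR suc) (T (φ l⊃ φ[Sx])))
        premise = subst (λ Z → S ▷ Γ₂ ⊢ entails Φ₂ Z) premise≡
                    (∀E (assum ⊢Φ (there (here refl))) (⊢⟨⟩ᵗ g₂ (lv vz)))
        ψ≡φ⁺ : S ▷ Γ₂ ⊢ prEq ψ (renPr (liftR suc) (T φ))
        ψ≡φ⁺ = subst (λ Z → S ▷ Γ₂ ⊢ prEq ψ Z) (tr-φ⁺ dℕ) (tr-dom-eq g₂ dTℕ̂ dℕ φ⁺)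
        φ[Sx]⁺≡ψ[Sx] : S ▷ Γ₂ ⊢ prEq (renPr (liftR suc) (T φ[Sx])) (subPr σsuc₁ ψ)
        φ[Sx]⁺≡ψ[Sx] = subst₂ (λ A B → S ▷ Γ₂ ⊢ prEq A B)
                         (trans (sym (sub-tr dℕ suc-tracks φ⁺)) (sym φ[Sx]⁺≡))
                         (sym (sub-tr dTℕ̂ suc-tracks φ⁺))
                         (tr-dom-eq g₂ dℕ dTℕ̂ (subLFm sucSubL φ⁺))

    sound : Ent Γ Hs (T (inductionScheme φ))
    sound = ⊃I (⊃I (∀I-hyps (stepCase ∷ baseCase ∷ Hs) (convEnt
              (subst (Ent (tℕ ∷ Γ) Hs₁) ψ[x]≡
                (indℕ {N = var 0} {φ = ψ} (analyticInd ψ (analytic-tr φ⁺)) (⊢tr g₂ dTℕ̂ φ⁺)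
                      (⊢⟨⟩ᵗ g₁ (lv vz)) base step))
              (tr-dom-eq g₁ dTℕ̂ dℕ φ))))

  SchemeOk : Theory → Set
  SchemeOk ACA₀ = ⊤
  SchemeOk ACA  = ∀ ψ → Analytic ψ → IndOk S ψ

  sound-axiom : ∀ {Th Δ Γ φ} → SchemeOk Th → Realises Δ Γ → (Hs : List (LFm Δ)) →
                Axiom Th Δ φ → Ent Γ Hs (T φ)
  sound-axiom ok g Hs axSuc0       = sound-suc≠0 g Hs
  sound-axiom ok g Hs axSucInj     = sound-suc-inj g Hs
  sound-axiom ok g Hs axAdd0       = sound-add0 g Hs
  sound-axiom ok g Hs axAddS       = sound-addS g Hs
  sound-axiom ok g Hs axMul0       = sound-mul0 g Hs
  sound-axiom ok g Hs axMulS       = sound-mulS g Hs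
  sound-axiom ok g Hs (axComp φ a) = sound-comprehension g Hs φ a
  sound-axiom ok g Hs axSetInd     = sound-set-ind g Hs
  sound-axiom ok g Hs (axInd φ)    = InductionScheme.sound ok g Hs φ

  -- Substitution
  -- instances are matched up by sub-tr; the rule (subst) applies because
  -- translations never quantify over types mentioning U.
  sound : ∀ {Th Δ Γ Hs φ} → SchemeOk Th → Realises Δ Γ → Prf Th Δ Hs φ → Ent Γ Hs (T φ)
  sound {Hs = Hs} ok g (hyp m)    = assum (⊢tr-hyps g dℕ Hs) (∈-map⁺ T m)
  sound {Hs = Hs} ok g (ax a)     = sound-axiom ok g Hs a
  sound {φ = φ} ok g (⊥e p)       = ⊥E (sound ok g p) (⊢tr g dℕ φ)
  sound ok g (⊃i p)               = ⊃I (sound ok g p)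
  sound ok g (⊃e p q)             = ⊃E (sound ok g p) (sound ok g q)
  sound ok g (dne p)              = DNE (sound ok g p)
  sound {Hs = Hs} ok g (∀ni p)    = ∀I-hyps Hs (sound ok (numʳ dℕ g) p)
  sound {Hs = Hs} ok g (∀si p)    = ∀I-hyps Hs (sound ok (setʳ g) p)
  sound {Γ = Γ} {Hs} ok g (∀ne {φ = φ} p t) =
    subst (Ent Γ Hs) (sub-tr dℕ (inst-tracks t) φ) (∀E (sound ok g p) (⊢⟨⟩ᵗ g t))
  sound {Γ = Γ} {Hs} ok g (∀se {φ = φ} p X) =
    subst (Ent Γ Hs) (sub-tr dℕ (instˢ-tracks X) φ) (∀E (sound ok g p) (⊢setVar g X))
  sound {Hs = Hs} ok g (≈refl t)  = =refl (⊢tr-hyps g dℕ Hs) (⊢⟨⟩ᵗ̂ g t)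
  sound {Γ = Γ} {Hs} ok g (≈subst {s = s} {t} φ p q) =
    subst (Ent Γ Hs) (sub-tr dℕ (inst-tracks t) φ)
      (=subst (substOk _ (noU-tr dℕ φ)) (⊢tr (numʳ dTℕ̂ g) dℕ φ) (sound ok g p)
        (subst (Ent Γ Hs) (sym (sub-tr dℕ (inst-tracks s) φ)) (sound ok g q)))

module Sound₀ = Soundness LTT0 tt (λ _ → isV) (λ _ nu → nu)
module Sound₀* = Soundness LTT0* tt (λ _ → anV) (λ _ nu → nu)
open Typing LTTW

mainTheorem1 : (m n : ℕ) (t : LTm (Δmn m n)) (φ : LFm (Δmn m n)) →
    ((LTTW ▷ Γmn m n ⊢ hasTy ⟨ t ⟩ᵗ tℕ) × (LTTW ▷ Γmn m n ⊢ isPr ⟨ φ ⟩ᶠ))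
    × ((a : Arith φ) →
         (LTTW ▷ Γmn m n ⊢ isSP ⟪ a ⟫) × (LTTW ▷ Γmn m n ⊢ prEq (fV ⟪ a ⟫) ⟨ φ ⟩ᶠ))
    × (ACA₀ ⊢ᴬ[ Δmn m n ] φ → LTT0 ▷ Γmn m n ⊢ entails [] ⟨ φ ⟩ᶠ)
    × (ACA ⊢ᴬ[ Δmn m n ] φ → LTT0* ▷ Γmn m n ⊢ entails [] ⟨ φ ⟩ᶠ)
-- ⟨φ⟩ᶠ is the ℕ-reading of the translation, and Γmn m n realises Δmn m n.
mainTheorem1 m n t φ rewrite sym (tr-dℕ φ) =
    (⊢⟨⟩ᵗ g t , ⊢tr g dℕ φ)
  , (λ a → ⊢⟪⟫ g a , V⟪⟫≡tr g dℕ a)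
  , Sound₀.sound tt g
  , Sound₀*.sound (λ _ an → an) g
  where g = realises-sortTy (Δmn m n)
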